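{- Let $n,\ell,u$ be integers (with $\ell,u\ge0$) such that $n\ge 4(\ell+u)$. Fix $L\subseteq\{0,\dots,\ell-1\}$ and $U\subseteq\{n-u,\dots,n-1\}$. Let $R$ be a uniformly randomly chosen subset of $\{\ell,\dots,n-u-1\}$ and set $A:=L\cup R\cup U$. Then the probability that \[ \{ -(n-\ell-u),\dots,n-\ell-u\}\subseteq A-A \] is greater than $1-4(1/2)^{|L|+|U|}-(n/2)(3/4)^{(n-\ell-u)/3}$.
   Context: $A-A=\{a_1-a_2: a_1,a_2\in A\}$. "Uniformly randomly chosen subset" means each of the $2^{n-\ell-u}$ subsets is chosen with equal probability. -}

module Defs where

open import Data.Nat as ℕ using (ℕ; zero; suc; _∸_)
open import Data.Integer as ℤ using (ℤ; +_)
open import Data.Rational as ℚ using (ℚ; _/_; 1ℚ)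
open import Data.Fin using (Fin; toℕ)
open import Data.Fin.Subset using (Subset; _∈_; inside; outside)
open import Data.Fin.Subset.Properties using (_∈?_)
open import Data.Fin.Properties using (any?; toℕ≤pred[n])
open import Data.Integer.Properties using (∣-i∣≡∣i∣)
open import Relation.Binary.PropositionalEquality using (subst; sym)
open import Data.Vec using ([]; _∷_)
open import Data.List using (List; []; _∷_; _++_; map; filter; length)
open import Data.Product using (Σ; _×_; _,_; ∃)
open import Data.Sum using (_⊎_)
open import Relation.Nullary using (Dec)
open import Relation.Nullary.Decidable using (_×-dec_; _⊎-dec_)
open import Relation.Binary.PropositionalEquality using (_≡_)

_^ℚ_ : ℚ → ℕ → ℚ
q ^ℚ zero = 1ℚ
q ^ℚ suc k = q ℚ.* (q ^ℚ k)

allSubsets : (m : ℕ) → List (Subset m)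
allSubsets zero = [] ∷ []
allSubsets (suc m) = map (inside ∷_) (allSubsets m) ++ map (outside ∷_) (allSubsets m)

-- A := L ∪ (ℓ + R) ∪ U, as a predicate on Fin n (the ground set {0,…,n-1}).
-- R is a subset of Fin m representing {ℓ,…,ℓ+m-1} via r ↦ ℓ + r.
InA : {n m : ℕ} (ℓ : ℕ) → Subset n → Subset n → Subset m → Fin n → Set
InA {m = m} ℓ L U R i = i ∈ L ⊎ (i ∈ U ⊎ Σ (Fin m) λ r → r ∈ R × (ℓ ℕ.+ toℕ r ≡ toℕ i))

InA? : {n m : ℕ} (ℓ : ℕ) (L U : Subset n) (R : Subset m) (i : Fin n) → Dec (InA ℓ L U R i)
InA? ℓ L U R i = (i ∈? L) ⊎-dec ((i ∈? U) ⊎-dec any? (λ r → (r ∈? R) ×-dec (ℓ ℕ.+ toℕ r ℕ.≟ toℕ i)))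

InDiff : {n m : ℕ} (ℓ : ℕ) → Subset n → Subset n → Subset m → ℤ → Set
InDiff ℓ L U R k = ∃ λ i → ∃ λ j → InA ℓ L U R i × InA ℓ L U R j × ((+ toℕ i) ℤ.- (+ toℕ j) ≡ k)

InDiff? : {n m : ℕ} (ℓ : ℕ) (L U : Subset n) (R : Subset m) (k : ℤ) → Dec (InDiff ℓ L U R k)
InDiff? ℓ L U R k = any? λ i → any? λ j → InA? ℓ L U R i ×-dec (InA? ℓ L U R j ×-dec ((+ toℕ i) ℤ.- (+ toℕ j) ℤ.≟ k))

Covers : {n m : ℕ} (ℓ : ℕ) → Subset n → Subset n → Subset m → Set
Covers {m = m} ℓ L U R = ∀ (k : ℤ) → ℤ.∣ k ∣ ℕ.≤ m → InDiff ℓ L U R k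

Covers? : {n m : ℕ} (ℓ : ℕ) (L U : Subset n) (R : Subset m) → Dec (Covers ℓ L U R)
Covers? {m = m} ℓ L U R = helper
  where
  open import Data.Fin using (Fin)
  open import Relation.Nullary using (yes; no; ¬_)
  open import Data.Nat.Properties using (≤-refl)
  open import Data.Nat using (_≤_; _<_)
  open import Data.Fin.Properties using (all?)
  open import Data.Fin using (fromℕ<; toℕ)
  P : Fin (suc m) → Set
  P t = InDiff ℓ L U R (+ toℕ t) × InDiff ℓ L U R (ℤ.- (+ toℕ t))
  P? : ∀ t → Dec (P t)
  P? t = InDiff? ℓ L U R (+ toℕ t) ×-dec InDiff? ℓ L U R (ℤ.- (+ toℕ t))
  helper : Dec (Covers ℓ L U R)
  helper with all? P?
  ... | yes all = yes λ k k≤m → cover k k≤m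
    where
    open import Data.Nat.Properties using (≤-<-trans; n<1+n)
    open import Data.Fin.Properties using (toℕ-fromℕ<)
    open import Data.Product using (proj₁; proj₂)
    cover : ∀ k → ℤ.∣ k ∣ ℕ.≤ m → InDiff ℓ L U R k
    cover (+ a) a≤m = subst (λ x → InDiff ℓ L U R (+ x)) (toℕ-fromℕ< (ℕ.s≤s a≤m))
                        (proj₁ (all (fromℕ< (ℕ.s≤s a≤m))))
    cover (ℤ.-[1+ a ]) a≤m = subst (λ x → InDiff ℓ L U R (ℤ.- (+ x))) (toℕ-fromℕ< (ℕ.s≤s a≤m))
                        (proj₂ (all (fromℕ< (ℕ.s≤s a≤m))))
  ... | no ¬all = no λ c → ¬all λ t →
          c (+ toℕ t) (toℕ≤pred[n] t)
           , c (ℤ.- (+ toℕ t)) (subst (ℕ._≤ m) (sym (∣-i∣≡∣i∣ (+ toℕ t))) (toℕ≤pred[n] t))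

goodCount : (n ℓ m : ℕ) → Subset n → Subset n → ℕ
goodCount n ℓ m L U = length (filter (Covers? ℓ L U) (allSubsets m))

-- x < y · (3/4)^(m/3)  (real exponent m/3), encoded without reals:
-- since t ↦ t³ is strictly increasing on ℝ, this is equivalent to
-- x³ < y³ · (3/4)^m.
LtTimes34PowThird : ℚ → ℚ → ℕ → Set
LtTimes34PowThird x y m = (x ^ℚ 3) ℚ.< (y ^ℚ 3) ℚ.* ((+ 3 / 4) ^ℚ m)

{-# OPTIONS --safe #-}
-- Let m = n − ℓ − u, so that A ∩ [ℓ, n − u) = ℓ + R for a uniform R ⊆ [0, m). Probabilities are
-- counts over the 2^m subsets R, and events are 0/1 weights (products of indicators), so that counts
-- factor along concatenations of subsets. If some k ∈ [1, m] is missing from A − A, then R avoids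
-- a family of disjoint forbidden pairs, each avoided by 3/4 of all R (1/2 if the pair meets L ∪ U):
--  * k ≤ n/2: pairs {p, p + k} inside R, k of them in each block of 2k positions; as 3k ≤ 2m there
--    are at least m/3 of them, so this k is missing with probability at most (3/4)^(m/3), and the
--    ⌊n/2⌋ such k give the second error term (compared after cubing, as m/3 is fractional);
--  * k = m − j > n/2: the j pairs {p, p + k} in R and the points of R in U − k and in L + k are
--    disjoint, so this k is missing with probability (3/4)^j / 2^(|L|+|U|); the geometric series
--    over j is below 4 / 2^(|L|+|U|).
module Submission where

open import Defs
open import Function using (_∘_)
open import Data.Bool using (Bool; true; false)
open import Data.Nat as ℕ using (ℕ; zero; suc; _+_; _*_; _^_; _∸_; _≤_; _<_; _≤?_; z≤n; s≤s; ⌊_/2⌋)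
open import Data.Nat.Properties
open import Data.Nat.Induction using (<-wellFounded)
open import Data.Nat.Tactic.RingSolver using (solve-∀)
open import Data.Nat.ListAction using (sum)
open import Data.Nat.ListAction.Properties using (sum-++)
open import Data.Nat.Coprimality using (1-coprimeTo) renaming (sym to coprime-sym)
open import Data.Integer as ℤ using (-[1+_])
import Data.Integer.Properties as ℤ
open import Data.Rational as ℚ using (ℚ; _/_; 1ℚ; 0ℚ; ½; toℚᵘ)
import Data.Rational.Properties as ℚ
import Data.Rational.Unnormalised as ℚᵘ
import Data.Rational.Unnormalised.Properties as ℚᵘ
open import Data.Rational.Solver using (module +-*-Solver)
open +-*-Solver using (solve; _:+_; _:*_; _:-_; _:=_; con)
open import Data.List as List using (map; filter; length)
open import Data.List.Properties using (map-++; map-∘)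
open import Data.Vec using ([]; _∷_; _++_; here; there)
open import Data.Fin using (toℕ; fromℕ<) renaming (zero to fzero; suc to fsuc)
open import Data.Fin.Properties using (toℕ<n; toℕ-fromℕ<; toℕ≤pred[n]; ¬∀⟶∃¬)
open import Data.Fin.Subset using (Subset; _∈_; ∣_∣; Nonempty)
open import Data.Fin.Subset.Properties using (nonempty?; Empty-unique; ∣⊥∣≡0)
open import Data.Product using (∃-syntax; _×_; _,_)
open import Data.Sum using (_⊎_; inj₁; inj₂)
open import Data.Empty using (⊥; ⊥-elim)
open import Induction.WellFounded using (Acc; acc)
open import Relation.Nullary using (Dec; yes; no; ¬_; ¬?; contradiction)
open import Relation.Binary.PropositionalEquality hiding ([_])

-- Sums over all subsets of Fin m

∑ₛ : (m : ℕ) → (Subset m → ℕ) → ℕ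
∑ₛ zero    f = f []
∑ₛ (suc m) f = ∑ₛ m (f ∘ (true ∷_)) + ∑ₛ m (f ∘ (false ∷_))

∑ₛ-cong : ∀ m {f g : Subset m → ℕ} → (∀ R → f R ≡ g R) → ∑ₛ m f ≡ ∑ₛ m g
∑ₛ-cong zero    f≡g = f≡g []
∑ₛ-cong (suc m) f≡g = cong₂ _+_ (∑ₛ-cong m (f≡g ∘ (true ∷_))) (∑ₛ-cong m (f≡g ∘ (false ∷_)))

∑ₛ-mono-≤ : ∀ m {f g : Subset m → ℕ} → (∀ R → f R ≤ g R) → ∑ₛ m f ≤ ∑ₛ m g
∑ₛ-mono-≤ zero    f≤g = f≤g []
∑ₛ-mono-≤ (suc m) f≤g = +-mono-≤ (∑ₛ-mono-≤ m (f≤g ∘ (true ∷_))) (∑ₛ-mono-≤ m (f≤g ∘ (false ∷_)))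

∑ₛ-distrib-+ : ∀ m (f g : Subset m → ℕ) → ∑ₛ m (λ R → f R + g R) ≡ ∑ₛ m f + ∑ₛ m g
∑ₛ-distrib-+ zero    f g = refl
∑ₛ-distrib-+ (suc m) f g = begin
  ∑ₛ m (λ R → f (true ∷ R) + g (true ∷ R)) + ∑ₛ m (λ R → f (false ∷ R) + g (false ∷ R))
    ≡⟨ cong₂ _+_ (∑ₛ-distrib-+ m _ _) (∑ₛ-distrib-+ m _ _) ⟩
  (a + b) + (c + d)
    ≡⟨ interchange a b c d ⟩
  (a + c) + (b + d) ∎
  where
  open ≡-Reasoning
  a = ∑ₛ m (f ∘ (true ∷_))
  b = ∑ₛ m (g ∘ (true ∷_))
  c = ∑ₛ m (f ∘ (false ∷_))
  d = ∑ₛ m (g ∘ (false ∷_))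
  interchange : ∀ a b c d → (a + b) + (c + d) ≡ (a + c) + (b + d)
  interchange = solve-∀

∑ₛ-*ˡ : ∀ m c (f : Subset m → ℕ) → ∑ₛ m (λ R → c * f R) ≡ c * ∑ₛ m f
∑ₛ-*ˡ zero    c f = refl
∑ₛ-*ˡ (suc m) c f = trans (cong₂ _+_ (∑ₛ-*ˡ m c _) (∑ₛ-*ˡ m c _)) (sym (*-distribˡ-+ c _ _))

∑ₛ-const : ∀ m c → ∑ₛ m (λ _ → c) ≡ 2 ^ m * c
∑ₛ-const zero    c = sym (+-identityʳ c)
∑ₛ-const (suc m) c = trans (cong₂ _+_ (∑ₛ-const m c) (∑ₛ-const m c)) (double (2 ^ m) c)
  where
  double : ∀ a c → a * c + a * c ≡ (2 * a) * c
  double = solve-∀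

∑ₛ-≤1 : ∀ m {f : Subset m → ℕ} → (∀ R → f R ≤ 1) → ∑ₛ m f ≤ 2 ^ m
∑ₛ-≤1 m f≤1 = ≤-trans (∑ₛ-mono-≤ m f≤1) (≤-reflexive (trans (∑ₛ-const m 1) (*-identityʳ (2 ^ m))))

∑ₛ-++ : ∀ a b (f : Subset (a + b) → ℕ) → ∑ₛ (a + b) f ≡ ∑ₛ a (λ v → ∑ₛ b (λ w → f (v ++ w)))
∑ₛ-++ zero    b f = refl
∑ₛ-++ (suc a) b f = cong₂ _+_ (∑ₛ-++ a b _) (∑ₛ-++ a b _)

∑ₛ-∑ₛ-* : ∀ a b (g : Subset a → ℕ) (h : Subset b → ℕ) → ∑ₛ a (λ v → ∑ₛ b (λ w → g v * h w)) ≡ ∑ₛ a g * ∑ₛ b h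
∑ₛ-∑ₛ-* a b g h = begin
  ∑ₛ a (λ v → ∑ₛ b (λ w → g v * h w)) ≡⟨ ∑ₛ-cong a (λ v → ∑ₛ-*ˡ b (g v) h) ⟩
  ∑ₛ a (λ v → g v * ∑ₛ b h)           ≡⟨ ∑ₛ-cong a (λ v → *-comm (g v) _) ⟩
  ∑ₛ a (λ v → ∑ₛ b h * g v)           ≡⟨ ∑ₛ-*ˡ a (∑ₛ b h) g ⟩
  ∑ₛ b h * ∑ₛ a g                     ≡⟨ *-comm (∑ₛ b h) _ ⟩
  ∑ₛ a g * ∑ₛ b h                     ∎
  where open ≡-Reasoning

∑ₛ-++-* : ∀ a b {f : Subset (a + b) → ℕ} (g : Subset a → ℕ) (h : Subset b → ℕ) →
  (∀ v w → f (v ++ w) ≡ g v * h w) → ∑ₛ (a + b) f ≡ ∑ₛ a g * ∑ₛ b h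
∑ₛ-++-* a b {f} g h f≡g*h =
  trans (∑ₛ-++ a b f) (trans (∑ₛ-cong a (λ v → ∑ₛ-cong b (f≡g*h v))) (∑ₛ-∑ₛ-* a b g h))

∑ₛ-++-≤-* : ∀ a b {f : Subset (a + b) → ℕ} (g : Subset a → ℕ) (h : Subset b → ℕ) →
  (∀ v w → f (v ++ w) ≤ g v * h w) → ∑ₛ (a + b) f ≤ ∑ₛ a g * ∑ₛ b h
∑ₛ-++-≤-* a b {f} g h f≤g*h = begin
  ∑ₛ (a + b) f                         ≡⟨ ∑ₛ-++ a b f ⟩
  ∑ₛ a (λ v → ∑ₛ b (λ w → f (v ++ w))) ≤⟨ ∑ₛ-mono-≤ a (λ v → ∑ₛ-mono-≤ b (f≤g*h v)) ⟩
  ∑ₛ a (λ v → ∑ₛ b (λ w → g v * h w))  ≡⟨ ∑ₛ-∑ₛ-* a b g h ⟩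
  ∑ₛ a g * ∑ₛ b h                      ∎
  where open ≤-Reasoning

χ : ∀ {m} → Subset m → ℕ → Bool
χ []      p       = false
χ (b ∷ R) zero    = b
χ (b ∷ R) (suc p) = χ R p

χ-++ˡ : ∀ {a b} (v : Subset a) (w : Subset b) {p} → p < a → χ (v ++ w) p ≡ χ v p
χ-++ˡ (x ∷ v) w {zero}  _         = refl
χ-++ˡ (x ∷ v) w {suc p} (s≤s p<a) = χ-++ˡ v w p<a

χ-++ʳ : ∀ {a b} (v : Subset a) (w : Subset b) p → χ (v ++ w) (a + p) ≡ χ w p
χ-++ʳ []      w p = refl
χ-++ʳ (x ∷ v) w p = χ-++ʳ v w p

χ-true : ∀ {m} (R : Subset m) {p} → χ R p ≡ true → ∃[ r ] toℕ r ≡ p × r ∈ R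
χ-true (true ∷ R) {zero}  _  = fzero , refl , here
χ-true (b ∷ R)    {suc p} eq with χ-true R eq
... | r , r≡p , r∈R = fsuc r , cong suc r≡p , there r∈R

-- Disjointness weights

notBoth : Bool → Bool → ℕ
notBoth true true = 0
notBoth _    _    = 1

notBoth≤1 : ∀ a b → notBoth a b ≤ 1
notBoth≤1 true  true  = z≤n
notBoth≤1 true  false = ≤-refl
notBoth≤1 false _     = ≤-refl

disjointOn : ℕ → (ℕ → Bool) → (ℕ → Bool) → ℕ
disjointOn zero    P ρ = 1
disjointOn (suc l) P ρ = notBoth (P 0) (ρ 0) * disjointOn l (P ∘ suc) (ρ ∘ suc)

disjointOn≤1 : ∀ l P ρ → disjointOn l P ρ ≤ 1
disjointOn≤1 zero    P ρ = ≤-refl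
disjointOn≤1 (suc l) P ρ = *-mono-≤ (notBoth≤1 (P 0) (ρ 0)) (disjointOn≤1 l _ _)

disjointOn-cong : ∀ l {P P′ ρ ρ′ : ℕ → Bool} →
  (∀ q → q < l → P q ≡ P′ q) → (∀ q → q < l → ρ q ≡ ρ′ q) → disjointOn l P ρ ≡ disjointOn l P′ ρ′
disjointOn-cong zero    P≡ ρ≡ = refl
disjointOn-cong (suc l) P≡ ρ≡ = cong₂ _*_ (cong₂ notBoth (P≡ 0 (s≤s z≤n)) (ρ≡ 0 (s≤s z≤n)))
  (disjointOn-cong l (λ q q<l → P≡ (suc q) (s≤s q<l)) (λ q q<l → ρ≡ (suc q) (s≤s q<l)))

disjointOn-+ : ∀ a b P ρ → disjointOn (a + b) P ρ ≡ disjointOn a P ρ * disjointOn b (P ∘ (a +_)) (ρ ∘ (a +_))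
disjointOn-+ zero    b P ρ = sym (+-identityʳ _)
disjointOn-+ (suc a) b P ρ = trans (cong (notBoth (P 0) (ρ 0) *_) (disjointOn-+ a b (P ∘ suc) (ρ ∘ suc)))
  (sym (*-assoc (notBoth (P 0) (ρ 0)) _ _))

disjointOn-antimono : ∀ {a b} P ρ → a ≤ b → disjointOn b P ρ ≤ disjointOn a P ρ
disjointOn-antimono {b = b} P ρ z≤n       = disjointOn≤1 b P ρ
disjointOn-antimono         P ρ (s≤s a≤b) = *-monoʳ-≤ (notBoth (P 0) (ρ 0)) (disjointOn-antimono _ _ a≤b)

disjointOn≡1 : ∀ l {P ρ} → (∀ q → P q ≡ true → ρ q ≡ true → ⊥) → disjointOn l P ρ ≡ 1
disjointOn≡1 zero    disj = refl
disjointOn≡1 (suc l) {P} {ρ} disj = cong₂ _*_ (head (P 0) (ρ 0) (disj 0)) (disjointOn≡1 l (disj ∘ suc))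
  where
  head : ∀ a b → (a ≡ true → b ≡ true → ⊥) → notBoth a b ≡ 1
  head true  true  ¬both = ⊥-elim (¬both refl refl)
  head true  false _     = refl
  head false _     _     = refl

disjointPairs-count : ∀ j → ∑ₛ j (λ v → ∑ₛ j (λ w → disjointOn j (χ v) (χ w))) ≡ 3 ^ j
disjointPairs-count zero    = refl
disjointPairs-count (suc j) = begin
  (∑ₛ j (λ v → ∑ₛ j (λ w → 0 * D v w) + ∑ₛ j (λ w → 1 * D v w))) +
  (∑ₛ j (λ v → ∑ₛ j (λ w → 1 * D v w) + ∑ₛ j (λ w → 1 * D v w)))
    ≡⟨ cong₂ _+_ (∑ₛ-cong j (λ v → cong₂ _+_ (∑ₛ-*ˡ j 0 (D v)) (∑ₛ-*ˡ j 1 (D v))))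
                 (∑ₛ-cong j (λ v → cong₂ _+_ (∑ₛ-*ˡ j 1 (D v)) (∑ₛ-*ˡ j 1 (D v)))) ⟩
  ∑ₛ j (λ v → 0 * ∑ₛ j (D v) + 1 * ∑ₛ j (D v)) + ∑ₛ j (λ v → 1 * ∑ₛ j (D v) + 1 * ∑ₛ j (D v))
    ≡⟨ cong₂ _+_ (∑ₛ-cong j (λ v → +-identityʳ (∑ₛ j (D v)))) (∑ₛ-cong j (λ v → sym (*-distribʳ-+ (∑ₛ j (D v)) 1 1))) ⟩
  ∑ₛ j (λ v → ∑ₛ j (D v)) + ∑ₛ j (λ v → 2 * ∑ₛ j (D v))
    ≡⟨ cong (∑ₛ j (λ v → ∑ₛ j (D v)) +_) (∑ₛ-*ˡ j 2 _) ⟩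
  ∑ₛ j (λ v → ∑ₛ j (D v)) + 2 * ∑ₛ j (λ v → ∑ₛ j (D v))
    ≡⟨ cong (λ x → x + 2 * x) (disjointPairs-count j) ⟩
  3 ^ j + 2 * 3 ^ j
    ≡⟨ triple (3 ^ j) ⟩
  3 * 3 ^ j ∎
  where
  open ≡-Reasoning
  D : Subset j → Subset j → ℕ
  D v w = disjointOn j (χ v) (χ w)
  triple : ∀ x → x + 2 * x ≡ 3 * x
  triple = solve-∀

countTrue : ℕ → (ℕ → Bool) → ℕ
countTrue zero    P = 0
countTrue (suc l) P with P 0
... | true  = suc (countTrue l (P ∘ suc))
... | false = countTrue l (P ∘ suc)

disjointFrom-count : ∀ l P → ∑ₛ l (λ v → disjointOn l P (χ v)) * 2 ^ countTrue l P ≡ 2 ^ l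
disjointFrom-count zero    P = refl
disjointFrom-count (suc l) P with P 0
... | true = begin
  (∑ₛ l (λ v → 0 * D v) + ∑ₛ l (λ v → 1 * D v)) * (2 * 2 ^ c)
    ≡⟨ cong (λ x → x * (2 * 2 ^ c)) (cong₂ _+_ (∑ₛ-*ˡ l 0 D) (∑ₛ-*ˡ l 1 D)) ⟩
  (0 * ∑ₛ l D + 1 * ∑ₛ l D) * (2 * 2 ^ c)
    ≡⟨ rearrange (∑ₛ l D) (2 ^ c) ⟩
  2 * (∑ₛ l D * 2 ^ c)
    ≡⟨ cong (2 *_) (disjointFrom-count l (P ∘ suc)) ⟩
  2 * 2 ^ l ∎
  where
  open ≡-Reasoning
  D : Subset l → ℕ
  D v = disjointOn l (P ∘ suc) (χ v)
  c = countTrue l (P ∘ suc)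
  rearrange : ∀ x y → (0 * x + 1 * x) * (2 * y) ≡ 2 * (x * y)
  rearrange = solve-∀
... | false = begin
  (∑ₛ l (λ v → 1 * D v) + ∑ₛ l (λ v → 1 * D v)) * 2 ^ c
    ≡⟨ cong (λ x → x * 2 ^ c) (cong₂ _+_ (∑ₛ-*ˡ l 1 D) (∑ₛ-*ˡ l 1 D)) ⟩
  (1 * ∑ₛ l D + 1 * ∑ₛ l D) * 2 ^ c
    ≡⟨ rearrange (∑ₛ l D) (2 ^ c) ⟩
  2 * (∑ₛ l D * 2 ^ c)
    ≡⟨ cong (2 *_) (disjointFrom-count l (P ∘ suc)) ⟩
  2 * 2 ^ l ∎
  where
  open ≡-Reasoning
  D : Subset l → ℕ
  D v = disjointOn l (P ∘ suc) (χ v)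
  c = countTrue l (P ∘ suc)
  rearrange : ∀ x y → (1 * x + 1 * x) * y ≡ 2 * (x * y)
  rearrange = solve-∀

countTrue-+ : ∀ a b P → countTrue (a + b) P ≡ countTrue a P + countTrue b (P ∘ (a +_))
countTrue-+ zero    b P = refl
countTrue-+ (suc a) b P with P 0
... | true  = cong suc (countTrue-+ a b (P ∘ suc))
... | false = countTrue-+ a b (P ∘ suc)

countTrue-none : ∀ b P → (∀ q → q < b → P q ≡ true → ⊥) → countTrue b P ≡ 0
countTrue-none zero    P none = refl
countTrue-none (suc b) P none with P 0 in P0≡
... | true  = ⊥-elim (none 0 (s≤s z≤n) P0≡)
... | false = countTrue-none b (P ∘ suc) (λ q q<b → none (suc q) (s≤s q<b))

∣p∣≡countTrue : ∀ {n} (p : Subset n) → ∣ p ∣ ≡ countTrue n (χ p)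
∣p∣≡countTrue []           = refl
∣p∣≡countTrue (true ∷ p)  = cong suc (∣p∣≡countTrue p)
∣p∣≡countTrue (false ∷ p) = ∣p∣≡countTrue p

∣p∣≡countTrue-window : ∀ {n} (p : Subset n) a b {c} → n ≡ a + (b + c) →
  (∀ i → i ∈ p → a ≤ toℕ i × toℕ i < a + b) → ∣ p ∣ ≡ countTrue b (χ p ∘ (a +_))
∣p∣≡countTrue-window {n} p a b {c} n≡ window = begin
  ∣ p ∣                                          ≡⟨ ∣p∣≡countTrue p ⟩
  countTrue n (χ p)                              ≡⟨ cong (λ x → countTrue x (χ p)) n≡ ⟩
  countTrue (a + (b + c)) (χ p)                  ≡⟨ countTrue-+ a (b + c) (χ p) ⟩
  countTrue a (χ p) + countTrue (b + c) (χ p ∘ (a +_))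
    ≡⟨ cong₂ _+_ (countTrue-none a (χ p) below) (countTrue-+ b c (χ p ∘ (a +_))) ⟩
  countTrue b (χ p ∘ (a +_)) + countTrue c (χ p ∘ (a +_) ∘ (b +_))
    ≡⟨ cong (countTrue b (χ p ∘ (a +_)) +_) (countTrue-none c _ (λ q _ → above q)) ⟩
  countTrue b (χ p ∘ (a +_)) + 0                 ≡⟨ +-identityʳ _ ⟩
  countTrue b (χ p ∘ (a +_))                     ∎
  where
  open ≡-Reasoning
  below : ∀ q → q < a → χ p q ≡ true → ⊥
  below q q<a q∈p with χ-true p q∈p
  ... | i , refl , i∈p with window i i∈p
  ...   | a≤i , _ = <⇒≱ q<a a≤i
  above : ∀ q → χ p (a + (b + q)) ≡ true → ⊥
  above q q∈p with χ-true p q∈p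
  ... | i , i≡ , i∈p with window i i∈p
  ...   | _ , i<a+b = <⇒≱ i<a+b (≤-trans (m≤m+n (a + b) q) (≤-reflexive (trans (+-assoc a b q) (sym i≡))))

-- Subsets without two elements at distance k

2^*4^≡2^ : ∀ {a} b c → a ≡ b + 2 * c → 2 ^ b * 4 ^ c ≡ 2 ^ a
2^*4^≡2^ b c refl = trans (cong (2 ^ b *_) (^-*-assoc 2 2 c)) (sym (^-distribˡ-+-* 2 b (2 * c)))

diffFree : ℕ → ℕ → (ℕ → Bool) → ℕ
diffFree k l ρ = disjointOn l ρ (ρ ∘ (k +_))

diffFree-sandwich : ∀ j Y {K} → K ≡ j + Y → (v : Subset j) (z : Subset Y) (w : Subset j) →
  diffFree K j (χ (v ++ (z ++ w))) ≡ disjointOn j (χ v) (χ w)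
diffFree-sandwich j Y refl v z w = disjointOn-cong j (λ q q<j → χ-++ˡ v (z ++ w) q<j) λ q _ → begin
  χ (v ++ (z ++ w)) (j + Y + q)   ≡⟨ cong (χ (v ++ (z ++ w))) (+-assoc j Y q) ⟩
  χ (v ++ (z ++ w)) (j + (Y + q)) ≡⟨ χ-++ʳ v (z ++ w) (Y + q) ⟩
  χ (z ++ w) (Y + q)              ≡⟨ χ-++ʳ z w q ⟩
  χ w q                           ∎
  where open ≡-Reasoning

-- The shift K = j + Y matches the first j positions of v ++ (z ++ w) with the last j.
∑ₛ-sandwich : ∀ j Y {K} → K ≡ j + Y → (F : Subset (j + (Y + j)) → ℕ) (Q : Subset Y → ℕ) →
  (∀ v z w → F (v ++ (z ++ w)) ≡ Q z) →
  ∑ₛ (j + (Y + j)) (λ R → diffFree K j (χ R) * F R) ≡ 3 ^ j * ∑ₛ Y Q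
∑ₛ-sandwich j Y {K} K≡j+Y F Q F≡Q = begin
  ∑ₛ (j + (Y + j)) (λ R → diffFree K j (χ R) * F R)
    ≡⟨ ∑ₛ-++ j (Y + j) _ ⟩
  ∑ₛ j (λ v → ∑ₛ (Y + j) (λ zw → diffFree K j (χ (v ++ zw)) * F (v ++ zw)))
    ≡⟨ ∑ₛ-cong j (λ v → ∑ₛ-++-* Y j Q (D v) (factor v)) ⟩
  ∑ₛ j (λ v → ∑ₛ Y Q * ∑ₛ j (D v))
    ≡⟨ ∑ₛ-*ˡ j (∑ₛ Y Q) _ ⟩
  ∑ₛ Y Q * ∑ₛ j (λ v → ∑ₛ j (D v))
    ≡⟨ cong (∑ₛ Y Q *_) (disjointPairs-count j) ⟩
  ∑ₛ Y Q * 3 ^ j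
    ≡⟨ *-comm (∑ₛ Y Q) _ ⟩
  3 ^ j * ∑ₛ Y Q ∎
  where
  open ≡-Reasoning
  D : Subset j → Subset j → ℕ
  D v w = disjointOn j (χ v) (χ w)
  factor : ∀ v z w → diffFree K j (χ (v ++ (z ++ w))) * F (v ++ (z ++ w)) ≡ Q z * D v w
  factor v z w = trans (cong₂ _*_ (diffFree-sandwich j Y K≡j+Y v z w) (F≡Q v z w)) (*-comm (D v w) (Q z))

diffFree-count : ∀ j Y {K} → K ≡ j + Y → ∑ₛ (j + (Y + j)) (λ R → diffFree K j (χ R)) ≡ 3 ^ j * 2 ^ Y
diffFree-count j Y K≡j+Y = begin
  ∑ₛ (j + (Y + j)) (λ R → diffFree _ j (χ R))     ≡⟨ ∑ₛ-cong (j + (Y + j)) (λ R → sym (*-identityʳ _)) ⟩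
  ∑ₛ (j + (Y + j)) (λ R → diffFree _ j (χ R) * 1) ≡⟨ ∑ₛ-sandwich j Y K≡j+Y (λ _ → 1) (λ _ → 1) (λ _ _ _ → refl) ⟩
  3 ^ j * ∑ₛ Y (λ _ → 1)                          ≡⟨ cong (3 ^ j *_) (trans (∑ₛ-const Y 1) (*-identityʳ (2 ^ Y))) ⟩
  3 ^ j * 2 ^ Y                                   ∎
  where open ≡-Reasoning

diffFreeCount : ℕ → ℕ → ℕ
diffFreeCount k m = ∑ₛ m (λ R → diffFree k m (χ R))

diffFreeCount-short : ∀ {k m} j c → k ≡ j + c → m ≡ j + (c + j) → diffFreeCount k m * 4 ^ j ≤ 3 ^ j * 2 ^ m
diffFreeCount-short j c refl refl = begin
  diffFreeCount (j + c) m * 4 ^ j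
    ≤⟨ *-monoˡ-≤ (4 ^ j) (∑ₛ-mono-≤ m (λ R → disjointOn-antimono (χ R) _ (m≤m+n j (c + j)))) ⟩
  ∑ₛ m (λ R → diffFree (j + c) j (χ R)) * 4 ^ j
    ≡⟨ cong (_* 4 ^ j) (diffFree-count j c refl) ⟩
  3 ^ j * 2 ^ c * 4 ^ j
    ≡⟨ *-assoc (3 ^ j) (2 ^ c) (4 ^ j) ⟩
  3 ^ j * (2 ^ c * 4 ^ j)
    ≡⟨ cong (3 ^ j *_) (2^*4^≡2^ c j (length≡ j c)) ⟩
  3 ^ j * 2 ^ m ∎
  where
  open ≤-Reasoning
  m = j + (c + j)
  length≡ : ∀ j c → j + (c + j) ≡ c + 2 * j
  length≡ = solve-∀

diffFree-+ : ∀ k a b ρ → diffFree k (a + b) ρ ≡ diffFree k a ρ * diffFree k b (ρ ∘ (a +_))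
diffFree-+ k a b ρ = trans (disjointOn-+ a b ρ (ρ ∘ (k +_)))
  (cong (diffFree k a ρ *_) (disjointOn-cong b (λ _ _ → refl) (λ q _ → cong ρ (swap k a q))))
  where
  swap : ∀ k a q → k + (a + q) ≡ a + (k + q)
  swap = solve-∀

diffFreeCount-block : ∀ k m → diffFreeCount k (k + k + m) ≤ 3 ^ k * diffFreeCount k m
diffFreeCount-block k m = begin
  diffFreeCount k (k + k + m)
    ≤⟨ ∑ₛ-++-≤-* (k + k) m (λ x → diffFree k k (χ x)) (λ r → diffFree k m (χ r)) split ⟩
  ∑ₛ (k + k) (λ x → diffFree k k (χ x)) * diffFreeCount k m
    ≡⟨ cong (_* diffFreeCount k m) (trans (diffFree-count k 0 (sym (+-identityʳ k))) (*-identityʳ (3 ^ k))) ⟩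
  3 ^ k * diffFreeCount k m ∎
  where
  open ≤-Reasoning
  split : ∀ x r → diffFree k (k + k + m) (χ (x ++ r)) ≤ diffFree k k (χ x) * diffFree k m (χ r)
  split x r = begin
    diffFree k (k + k + m) (χ (x ++ r))
      ≡⟨ diffFree-+ k (k + k) m (χ (x ++ r)) ⟩
    diffFree k (k + k) (χ (x ++ r)) * diffFree k m (χ (x ++ r) ∘ (k + k +_))
      ≡⟨ cong (diffFree k (k + k) (χ (x ++ r)) *_) (disjointOn-cong m (λ q _ → χ-++ʳ x r q) (λ q _ → χ-++ʳ x r (k + q))) ⟩
    diffFree k (k + k) (χ (x ++ r)) * diffFree k m (χ r)
      ≤⟨ *-monoˡ-≤ _ (disjointOn-antimono (χ (x ++ r)) _ (m≤m+n k k)) ⟩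
    diffFree k k (χ (x ++ r)) * diffFree k m (χ r)
      ≡⟨ cong (_* diffFree k m (χ r)) (disjointOn-cong k (λ q q<k → χ-++ˡ x r (≤-trans q<k (m≤m+n k k)))
                                                          (λ q q<k → χ-++ˡ x r (+-monoʳ-< k q<k))) ⟩
    diffFree k k (χ x) * diffFree k m (χ r) ∎

diffFreeCount-step : ∀ k m t → diffFreeCount k m * 4 ^ t ≤ 3 ^ t * 2 ^ m →
  diffFreeCount k (k + k + m) * 4 ^ (k + t) ≤ 3 ^ (k + t) * 2 ^ (k + k + m)
diffFreeCount-step k m t bound = begin
  diffFreeCount k (k + k + m) * 4 ^ (k + t)
    ≤⟨ *-mono-≤ (diffFreeCount-block k m) (≤-reflexive (^-distribˡ-+-* 4 k t)) ⟩
  3 ^ k * diffFreeCount k m * (4 ^ k * 4 ^ t)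
    ≡⟨ regroup (3 ^ k) (diffFreeCount k m) (4 ^ k) (4 ^ t) ⟩
  3 ^ k * 4 ^ k * (diffFreeCount k m * 4 ^ t)
    ≤⟨ *-monoʳ-≤ (3 ^ k * 4 ^ k) bound ⟩
  3 ^ k * 4 ^ k * (3 ^ t * 2 ^ m)
    ≡⟨ regroup′ (3 ^ k) (4 ^ k) (3 ^ t) (2 ^ m) ⟩
  3 ^ k * 3 ^ t * (2 ^ m * 4 ^ k)
    ≡⟨ cong₂ _*_ (sym (^-distribˡ-+-* 3 k t)) (2^*4^≡2^ m k (length≡ k m)) ⟩
  3 ^ (k + t) * 2 ^ (k + k + m) ∎
  where
  open ≤-Reasoning
  regroup : ∀ x a y z → x * a * (y * z) ≡ x * y * (a * z)
  regroup = solve-∀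
  regroup′ : ∀ x y z w → x * y * (z * w) ≡ x * z * (w * y)
  regroup′ = solve-∀
  length≡ : ∀ k m → k + k + m ≡ m + 2 * k
  length≡ = solve-∀

pairs-invariant : ∀ k m t → m ≤ 3 * t ⊎ m ≤ k + t → k + k + m ≤ 3 * (k + t)
pairs-invariant k m t m≤ = ≤-trans (+-monoʳ-≤ (k + k) (m≤k+3t m≤)) (≤-reflexive (length≡ k t))
  where
  m≤k+3t : m ≤ 3 * t ⊎ m ≤ k + t → m ≤ k + 3 * t
  m≤k+3t (inj₁ m≤3t)  = ≤-trans m≤3t (m≤n+m (3 * t) k)
  m≤k+3t (inj₂ m≤k+t) = ≤-trans m≤k+t (+-monoʳ-≤ k (m≤n*m t 3))
  length≡ : ∀ k t → k + k + (k + 3 * t) ≡ 3 * (k + t)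
  length≡ = solve-∀

-- t counts disjoint pairs at distance k: k from each block of 2k positions, and m ∸ k from a final block shorter than 2k.
diffFreeCount-bound : ∀ {k} → 1 ≤ k → ∀ m → Acc _<_ m →
  ∃[ t ] (m ≤ 3 * t ⊎ m ≤ k + t) × diffFreeCount k m * 4 ^ t ≤ 3 ^ t * 2 ^ m
diffFreeCount-bound {k} 1≤k m (acc rec) with m ≤? k | m ≤? k + k
... | yes m≤k | _ = 0 , inj₂ (≤-trans m≤k (m≤m+n k 0)) , (begin
  diffFreeCount k m * 1 ≡⟨ *-identityʳ _ ⟩
  diffFreeCount k m     ≤⟨ ∑ₛ-≤1 m (λ R → disjointOn≤1 m _ _) ⟩
  2 ^ m                 ≡⟨ *-identityˡ _ ⟨
  1 * 2 ^ m             ∎)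
  where open ≤-Reasoning
... | no m≰k | yes m≤2k = j , inj₂ (≤-reflexive m≡k+j) , diffFreeCount-short j c k≡j+c m≡j+[c+j]
  where
  j = m ∸ k
  m≡k+j : m ≡ k + j
  m≡k+j = sym (m+[n∸m]≡n (<⇒≤ (≰⇒> m≰k)))
  c = k ∸ j
  k≡j+c : k ≡ j + c
  k≡j+c = sym (m+[n∸m]≡n (+-cancelˡ-≤ k j k (subst (_≤ k + k) m≡k+j m≤2k)))
  m≡j+[c+j] : m ≡ j + (c + j)
  m≡j+[c+j] = trans m≡k+j (trans (cong (_+ j) k≡j+c) (+-assoc j c j))
... | no _ | no m≰2k with m≤n⇒∃[o]m+o≡n (<⇒≤ (≰⇒> m≰2k))
...   | m′ , refl with diffFreeCount-bound 1≤k m′ (rec (m<n+m m′ (+-mono-≤ 1≤k z≤n)))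
...     | t , invariant , bound = k + t , inj₁ (pairs-invariant k m′ t invariant) , diffFreeCount-step k m′ t bound

^3-distrib-* : ∀ a b → (a * b) ^ 3 ≡ a ^ 3 * b ^ 3
^3-distrib-* = expanded
  where
  expanded : ∀ a b → (a * b) * ((a * b) * ((a * b) * 1)) ≡ (a * (a * (a * 1))) * (b * (b * (b * 1)))
  expanded = solve-∀

-- a ≤ 2^m (3/4)^t with m ≤ 3t, in cubed form: a ≤ 2^m (3/4)^(m/3).
^3-bound : ∀ a t {m} → a * 4 ^ t ≤ 3 ^ t * 2 ^ m → m ≤ 3 * t → a ^ 3 ≤ 3 ^ m * 2 ^ m
^3-bound a t {m} bound m≤3t with m≤n⇒∃[o]m+o≡n m≤3t
... | e , m+e≡3t = *-cancelʳ-≤ (a ^ 3) (3 ^ m * 2 ^ m) (4 ^ (m + e)) {{m^n≢0 4 (m + e)}} (begin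
  a ^ 3 * 4 ^ (m + e)             ≡⟨ cong (a ^ 3 *_) (cubed 4) ⟨
  a ^ 3 * (4 ^ t) ^ 3             ≡⟨ ^3-distrib-* a (4 ^ t) ⟨
  (a * 4 ^ t) ^ 3                 ≤⟨ ^-monoˡ-≤ 3 bound ⟩
  (3 ^ t * 2 ^ m) ^ 3             ≡⟨ ^3-distrib-* (3 ^ t) (2 ^ m) ⟩
  (3 ^ t) ^ 3 * (2 ^ m) ^ 3       ≡⟨ cong₂ _*_ (trans (cubed 3) (^-distribˡ-+-* 3 m e)) 2^m-cubed ⟩
  3 ^ m * 3 ^ e * (2 ^ m * 4 ^ m) ≤⟨ *-monoˡ-≤ _ (*-monoʳ-≤ (3 ^ m) (^-monoˡ-≤ e (n≤1+n 3))) ⟩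
  3 ^ m * 4 ^ e * (2 ^ m * 4 ^ m) ≡⟨ regroup (3 ^ m) (4 ^ e) (2 ^ m) (4 ^ m) ⟩
  3 ^ m * 2 ^ m * (4 ^ m * 4 ^ e) ≡⟨ cong (3 ^ m * 2 ^ m *_) (^-distribˡ-+-* 4 m e) ⟨
  3 ^ m * 2 ^ m * 4 ^ (m + e)     ∎)
  where
  open ≤-Reasoning
  cubed : ∀ x → (x ^ t) ^ 3 ≡ x ^ (m + e)
  cubed x = trans (^-*-assoc x t 3) (cong (x ^_) (trans (*-comm t 3) (sym m+e≡3t)))
  triple : ∀ m → m * 3 ≡ m + 2 * m
  triple = solve-∀
  2^m-cubed : (2 ^ m) ^ 3 ≡ 2 ^ m * 4 ^ m
  2^m-cubed = trans (^-*-assoc 2 m 3) (sym (2^*4^≡2^ m m (triple m)))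
  regroup : ∀ x y z w → x * y * (z * w) ≡ x * z * (w * y)
  regroup = solve-∀

diffFreeCount-cube : ∀ {k m} → 1 ≤ k → 3 * k ≤ 2 * m → diffFreeCount k m ^ 3 ≤ 3 ^ m * 2 ^ m
diffFreeCount-cube {k} {m} 1≤k 3k≤2m with diffFreeCount-bound 1≤k m (<-wellFounded m)
... | t , inj₁ m≤3t   , bound = ^3-bound (diffFreeCount k m) t bound m≤3t
... | t , inj₂ m≤k+t , bound = ^3-bound (diffFreeCount k m) t bound (+-cancelˡ-≤ (2 * m) m (3 * t) (begin
  2 * m + m       ≡⟨ +-comm (2 * m) m ⟩
  3 * m           ≤⟨ *-monoʳ-≤ 3 m≤k+t ⟩
  3 * (k + t)     ≡⟨ *-distribˡ-+ 3 k t ⟩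
  3 * k + 3 * t   ≤⟨ +-monoˡ-≤ (3 * t) 3k≤2m ⟩
  2 * m + 3 * t   ∎))
  where open ≤-Reasoning

windows-count : ∀ u M ℓ (PU PL : ℕ → Bool) →
  ∑ₛ (u + (M + ℓ)) (λ z → disjointOn u PU (χ z) * disjointOn ℓ PL (χ z ∘ (u + M +_)))
    * 2 ^ (countTrue u PU + countTrue ℓ PL) ≡ 2 ^ (u + (M + ℓ))
windows-count u M ℓ PU PL = begin
  ∑ₛ (u + (M + ℓ)) Q * 2 ^ (cU + cL)
    ≡⟨ cong₂ _*_ (∑ₛ-++-* u (M + ℓ) A B Q≡A*B) (^-distribˡ-+-* 2 cU cL) ⟩
  ∑ₛ u A * ∑ₛ (M + ℓ) B * (2 ^ cU * 2 ^ cL)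
    ≡⟨ cong (λ x → ∑ₛ u A * x * (2 ^ cU * 2 ^ cL)) (∑ₛ-++-* M ℓ (λ _ → 1) C B≡1*C) ⟩
  ∑ₛ u A * (∑ₛ M (λ _ → 1) * ∑ₛ ℓ C) * (2 ^ cU * 2 ^ cL)
    ≡⟨ regroup (∑ₛ u A) (∑ₛ M (λ _ → 1)) (∑ₛ ℓ C) (2 ^ cU) (2 ^ cL) ⟩
  (∑ₛ u A * 2 ^ cU) * (∑ₛ M (λ _ → 1) * (∑ₛ ℓ C * 2 ^ cL))
    ≡⟨ cong₂ (λ x y → x * (∑ₛ M (λ _ → 1) * y)) (disjointFrom-count u PU) (disjointFrom-count ℓ PL) ⟩
  2 ^ u * (∑ₛ M (λ _ → 1) * 2 ^ ℓ)
    ≡⟨ cong (λ x → 2 ^ u * (x * 2 ^ ℓ)) (trans (∑ₛ-const M 1) (*-identityʳ (2 ^ M))) ⟩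
  2 ^ u * (2 ^ M * 2 ^ ℓ)
    ≡⟨ trans (^-distribˡ-+-* 2 u (M + ℓ)) (cong (2 ^ u *_) (^-distribˡ-+-* 2 M ℓ)) ⟨
  2 ^ (u + (M + ℓ)) ∎
  where
  open ≡-Reasoning
  cU = countTrue u PU
  cL = countTrue ℓ PL
  Q : Subset (u + (M + ℓ)) → ℕ
  Q z = disjointOn u PU (χ z) * disjointOn ℓ PL (χ z ∘ (u + M +_))
  A : Subset u → ℕ
  A a = disjointOn u PU (χ a)
  B : Subset (M + ℓ) → ℕ
  B bc = disjointOn ℓ PL (χ bc ∘ (M +_))
  C : Subset ℓ → ℕ
  C c = disjointOn ℓ PL (χ c)
  Q≡A*B : ∀ a bc → Q (a ++ bc) ≡ A a * B bc
  Q≡A*B a bc = cong₂ _*_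
    (disjointOn-cong u (λ _ _ → refl) (λ q q<u → χ-++ˡ a bc q<u))
    (disjointOn-cong ℓ (λ _ _ → refl) (λ q _ → trans (cong (χ (a ++ bc)) (+-assoc u M q)) (χ-++ʳ a bc (M + q))))
  B≡1*C : ∀ b c → B (b ++ c) ≡ 1 * C c
  B≡1*C b c = trans (disjointOn-cong ℓ (λ _ _ → refl) (λ q _ → χ-++ʳ b c q)) (sym (*-identityˡ _))
  regroup : ∀ a m c x y → a * (m * c) * (x * y) ≡ (a * x) * (m * (c * y))
  regroup = solve-∀

crossFree-count : ∀ {m K o} j u M ℓ (PU PL : ℕ → Bool) →
  m ≡ j + ((u + (M + ℓ)) + j) → K ≡ j + (u + (M + ℓ)) → o ≡ j + (u + M) →
  ∑ₛ m (λ R → diffFree K j (χ R) * (disjointOn u PU (χ R ∘ (j +_)) * disjointOn ℓ PL (χ R ∘ (o +_))))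
    * 4 ^ j * 2 ^ (countTrue u PU + countTrue ℓ PL) ≡ 3 ^ j * 2 ^ m
crossFree-count {m} j u M ℓ PU PL refl refl refl = begin
  ∑ₛ m (λ R → diffFree (j + Y) j (χ R) * G R) * 4 ^ j * 2 ^ c
    ≡⟨ cong (λ x → x * 4 ^ j * 2 ^ c) (∑ₛ-sandwich j Y refl G Q G≡Q) ⟩
  3 ^ j * ∑ₛ Y Q * 4 ^ j * 2 ^ c
    ≡⟨ regroup (3 ^ j) (∑ₛ Y Q) (4 ^ j) (2 ^ c) ⟩
  3 ^ j * (∑ₛ Y Q * 2 ^ c * 4 ^ j)
    ≡⟨ cong (λ x → 3 ^ j * (x * 4 ^ j)) (windows-count u M ℓ PU PL) ⟩
  3 ^ j * (2 ^ Y * 4 ^ j)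
    ≡⟨ cong (3 ^ j *_) (2^*4^≡2^ Y j (length≡ j Y)) ⟩
  3 ^ j * 2 ^ m ∎
  where
  open ≡-Reasoning
  Y = u + (M + ℓ)
  c = countTrue u PU + countTrue ℓ PL
  G : Subset m → ℕ
  G R = disjointOn u PU (χ R ∘ (j +_)) * disjointOn ℓ PL (χ R ∘ (j + (u + M) +_))
  Q : Subset Y → ℕ
  Q z = disjointOn u PU (χ z) * disjointOn ℓ PL (χ z ∘ (u + M +_))
  G≡Q : ∀ v z w → G (v ++ (z ++ w)) ≡ Q z
  G≡Q v z w = cong₂ _*_
    (disjointOn-cong u (λ _ _ → refl) λ q q<u →
      trans (χ-++ʳ v (z ++ w) q) (χ-++ˡ z w (≤-trans q<u (m≤m+n u (M + ℓ)))))
    (disjointOn-cong ℓ (λ _ _ → refl) λ q q<ℓ →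
      trans (cong (χ (v ++ (z ++ w))) (+-assoc j (u + M) q))
        (trans (χ-++ʳ v (z ++ w) (u + M + q)) (χ-++ˡ z w (≤-trans (+-monoʳ-< (u + M) q<ℓ) (≤-reflexive (+-assoc u M ℓ))))))
  regroup : ∀ a b x y → a * b * x * y ≡ a * (b * y * x)
  regroup = solve-∀
  length≡ : ∀ j Y → j + (Y + j) ≡ Y + 2 * j
  length≡ = solve-∀

∑< : ℕ → (ℕ → ℕ) → ℕ
∑< zero    f = 0
∑< (suc N) f = f 0 + ∑< N (f ∘ suc)

∑<-≥ : ∀ N f {i} → i < N → f i ≤ ∑< N f
∑<-≥ (suc N) f {zero}  _         = m≤m+n (f 0) _
∑<-≥ (suc N) f {suc i} (s≤s i<N) = ≤-trans (∑<-≥ N (f ∘ suc) i<N) (m≤n+m _ (f 0))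

∑<-≤-* : ∀ N f {a} → (∀ i → i < N → f i ≤ a) → ∑< N f ≤ N * a
∑<-≤-* zero    f f≤a = z≤n
∑<-≤-* (suc N) f f≤a = +-mono-≤ (f≤a 0 (s≤s z≤n)) (∑<-≤-* N (f ∘ suc) (λ i i<N → f≤a (suc i) (s≤s i<N)))

∑ₛ-∑< : ∀ m N (f : ℕ → Subset m → ℕ) → ∑ₛ m (λ R → ∑< N (λ i → f i R)) ≡ ∑< N (λ i → ∑ₛ m (f i))
∑ₛ-∑< m zero    f = trans (∑ₛ-const m 0) (*-zeroʳ (2 ^ m))
∑ₛ-∑< m (suc N) f = trans (∑ₛ-distrib-+ m (f 0) _) (cong (∑ₛ m (f 0) +_) (∑ₛ-∑< m N (f ∘ suc)))

majorant-^3 : ∀ N (f : ℕ → ℕ) C → (∀ i → i < N → f i ^ 3 ≤ C) → ∃[ a ] (∀ i → i < N → f i ≤ a) × a ^ 3 ≤ C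
majorant-^3 zero    f C _    = 0 , (λ _ ()) , z≤n
majorant-^3 (suc N) f C f³≤C with majorant-^3 N (f ∘ suc) C (λ i i<N → f³≤C (suc i) (s≤s i<N))
... | a , f≤a , a³≤C with f 0 ≤? a
...   | yes f0≤a = a , (λ { zero _ → f0≤a ; (suc i) (s≤s i<N) → f≤a i i<N }) , a³≤C
...   | no  f0≰a = f 0 , (λ { zero _ → ≤-refl ; (suc i) (s≤s i<N) → ≤-trans (f≤a i i<N) (<⇒≤ (≰⇒> f0≰a)) }) , f³≤C 0 (s≤s z≤n)

∑<-^3 : ∀ N (f : ℕ → ℕ) C → (∀ i → i < N → f i ^ 3 ≤ C) → ∑< N f ^ 3 ≤ N ^ 3 * C
∑<-^3 N f C f³≤C with majorant-^3 N f C f³≤C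
... | a , f≤a , a³≤C = begin
  ∑< N f ^ 3    ≤⟨ ^-monoˡ-≤ 3 (∑<-≤-* N f f≤a) ⟩
  (N * a) ^ 3   ≡⟨ ^3-distrib-* N a ⟩
  N ^ 3 * a ^ 3 ≤⟨ *-monoʳ-≤ (N ^ 3) a³≤C ⟩
  N ^ 3 * C     ∎
  where open ≤-Reasoning

-- Σ_{j<N} (3/4)^j = 4 − 4 (3/4)^N, with denominators cleared.
∑<-geometric : ∀ N c X Y → (∀ j → j < N → c j * 4 ^ j * X ≤ 3 ^ j * Y) →
  ∑< N c * X * 4 ^ N + 4 * 3 ^ N * Y ≤ 4 * 4 ^ N * Y
∑<-geometric zero    c X Y bound = ≤-refl
∑<-geometric (suc N) c X Y bound = begin
  (c 0 + S) * X * (4 * 4 ^ N) + 4 * (3 * 3 ^ N) * Y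
    ≡⟨ regroup (c 0) S X (4 ^ N) (3 ^ N) Y ⟩
  4 * 4 ^ N * (c 0 * X) + (S * (4 * X) * 4 ^ N + 4 * 3 ^ N * (3 * Y))
    ≤⟨ +-mono-≤ (*-monoʳ-≤ (4 * 4 ^ N) head) tail ⟩
  4 * 4 ^ N * Y + 4 * 4 ^ N * (3 * Y)
    ≡⟨ regroup′ (4 ^ N) Y ⟩
  4 * (4 * 4 ^ N) * Y ∎
  where
  open ≤-Reasoning
  S = ∑< N (c ∘ suc)
  head : c 0 * X ≤ Y
  head = ≤-trans (≤-reflexive (cong (_* X) (sym (*-identityʳ (c 0))))) (≤-trans (bound 0 (s≤s z≤n)) (≤-reflexive (*-identityˡ Y)))
  shifted : ∀ a b x → a * b * (4 * x) ≡ a * (4 * b) * x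
  shifted = solve-∀
  shifted′ : ∀ a y → 3 * a * y ≡ a * (3 * y)
  shifted′ = solve-∀
  tail : S * (4 * X) * 4 ^ N + 4 * 3 ^ N * (3 * Y) ≤ 4 * 4 ^ N * (3 * Y)
  tail = ∑<-geometric N (c ∘ suc) (4 * X) (3 * Y) λ j j<N → begin
    c (suc j) * 4 ^ j * (4 * X) ≡⟨ shifted (c (suc j)) (4 ^ j) X ⟩
    c (suc j) * 4 ^ suc j * X   ≤⟨ bound (suc j) (s≤s j<N) ⟩
    3 ^ suc j * Y               ≡⟨ shifted′ (3 ^ j) Y ⟩
    3 ^ j * (3 * Y)             ∎
  regroup : ∀ c₀ s x p q y → (c₀ + s) * x * (4 * p) + 4 * (3 * q) * y ≡ 4 * p * (c₀ * x) + (s * (4 * x) * p + 4 * q * (3 * y))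
  regroup = solve-∀
  regroup′ : ∀ p y → 4 * p * y + 4 * p * (3 * y) ≡ 4 * (4 * p) * y
  regroup′ = solve-∀

∑<-geometric-< : ∀ N c X Y → 1 ≤ Y → (∀ j → j < N → c j * 4 ^ j * X ≤ 3 ^ j * Y) → ∑< N c * X < 4 * Y
∑<-geometric-< N c X Y 1≤Y bound = *-cancelʳ-< (4 ^ N) (∑< N c * X) (4 * Y) (begin-strict
  ∑< N c * X * 4 ^ N                      <⟨ m<m+n _ (*-mono-≤ (*-mono-≤ (s≤s (z≤n {3})) (m^n>0 3 N)) 1≤Y) ⟩
  ∑< N c * X * 4 ^ N + 4 * 3 ^ N * Y      ≤⟨ ∑<-geometric N c X Y bound ⟩
  4 * 4 ^ N * Y                           ≡⟨ *-assoc 4 (4 ^ N) Y ⟩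
  4 * (4 ^ N * Y)                         ≡⟨ cong (4 *_) (*-comm (4 ^ N) Y) ⟩
  4 * (Y * 4 ^ N)                         ≡⟨ *-assoc 4 Y (4 ^ N) ⟨
  4 * Y * 4 ^ N                           ∎)
  where open ≤-Reasoning

[_] : ∀ {p} {P : Set p} → Dec P → ℕ
[ yes _ ] = 1
[ no  _ ] = 0

[P]+[¬P]≡1 : ∀ {p} {P : Set p} (P? : Dec P) → [ P? ] + [ ¬? P? ] ≡ 1
[P]+[¬P]≡1 (yes _) = refl
[P]+[¬P]≡1 (no  _) = refl

length-filter≡sum : ∀ {A : Set} {P : A → Set} (P? : ∀ x → Dec (P x)) xs →
  length (filter P? xs) ≡ sum (map (λ x → [ P? x ]) xs)
length-filter≡sum P? List.[]         = refl
length-filter≡sum P? (x List.∷ xs) with P? x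
... | yes _ = cong suc (length-filter≡sum P? xs)
... | no  _ = length-filter≡sum P? xs

∑ₛ-allSubsets : ∀ m f → ∑ₛ m f ≡ sum (map f (allSubsets m))
∑ₛ-allSubsets zero    f = sym (+-identityʳ (f []))
∑ₛ-allSubsets (suc m) f = sym (begin
  sum (map f (map (true ∷_) S List.++ map (false ∷_) S))
    ≡⟨ cong sum (map-++ f (map (true ∷_) S) _) ⟩
  sum (map f (map (true ∷_) S) List.++ map f (map (false ∷_) S))
    ≡⟨ sum-++ (map f (map (true ∷_) S)) _ ⟩
  sum (map f (map (true ∷_) S)) + sum (map f (map (false ∷_) S))
    ≡⟨ cong₂ _+_ (cong sum (map-∘ S)) (cong sum (map-∘ S)) ⟨
  sum (map (f ∘ (true ∷_)) S) + sum (map (f ∘ (false ∷_)) S)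
    ≡⟨ cong₂ _+_ (∑ₛ-allSubsets m _) (∑ₛ-allSubsets m _) ⟨
  ∑ₛ (suc m) f ∎)
  where
  open ≡-Reasoning
  S = allSubsets m

badCount : (n ℓ m : ℕ) → Subset n → Subset n → ℕ
badCount n ℓ m L U = ∑ₛ m (λ R → [ ¬? (Covers? ℓ L U R) ])

goodCount+badCount : ∀ n ℓ m L U → goodCount n ℓ m L U + badCount n ℓ m L U ≡ 2 ^ m
goodCount+badCount n ℓ m L U = begin
  goodCount n ℓ m L U + badCount n ℓ m L U
    ≡⟨ cong (_+ badCount n ℓ m L U) (trans (length-filter≡sum (Covers? ℓ L U) (allSubsets m)) (sym (∑ₛ-allSubsets m _))) ⟩
  ∑ₛ m (λ R → [ Covers? ℓ L U R ]) + badCount n ℓ m L U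
    ≡⟨ ∑ₛ-distrib-+ m _ _ ⟨
  ∑ₛ m (λ R → [ Covers? ℓ L U R ] + [ ¬? (Covers? ℓ L U R) ])
    ≡⟨ ∑ₛ-cong m (λ R → [P]+[¬P]≡1 (Covers? ℓ L U R)) ⟩
  ∑ₛ m (λ _ → 1)
    ≡⟨ trans (∑ₛ-const m 1) (*-identityʳ (2 ^ m)) ⟩
  2 ^ m ∎
  where open ≡-Reasoning

1≤∣p∣⇒nonempty : ∀ {n} (p : Subset n) → 1 ≤ ∣ p ∣ → Nonempty p
1≤∣p∣⇒nonempty {n} p 1≤∣p∣ with nonempty? p
... | yes p≢∅ = p≢∅
... | no  p≡∅ = contradiction (subst (1 ≤_) (trans (cong ∣_∣ (Empty-unique p≡∅)) (∣⊥∣≡0 n)) 1≤∣p∣) λ ()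

[a+k]-a≡k : ∀ a k → ℤ.+ (a + k) ℤ.- ℤ.+ a ≡ ℤ.+ k
[a+k]-a≡k a k = trans (ℤ.m-n≡m⊖n (a + k) a) (trans (ℤ.⊖-≥ (m≤m+n a k)) (cong ℤ.+_ (m+n∸m≡n a k)))

-[i-j]≡j-i : ∀ i j → ℤ.- (i ℤ.- j) ≡ j ℤ.- i
-[i-j]≡j-i i j = trans (ℤ.neg-distrib-+ i (ℤ.- j)) (trans (cong (ℤ._+_ (ℤ.- i)) (ℤ.neg-involutive j)) (ℤ.+-comm (ℤ.- i) j))

module _ {n m : ℕ} (ℓ : ℕ) (L U : Subset n) (R : Subset m) where

  InAℕ : ℕ → Set
  InAℕ a = ∃[ i ] toℕ i ≡ a × InA ℓ L U R i

  InDiff-+ : ∀ {a k} → InAℕ a → InAℕ (a + k) → InDiff ℓ L U R (ℤ.+ k)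
  InDiff-+ {a} {k} (j , refl , j∈A) (i , i≡a+k , i∈A) = i , j , i∈A , j∈A , subst (λ x → ℤ.+ x ℤ.- ℤ.+ a ≡ ℤ.+ k) (sym i≡a+k) ([a+k]-a≡k a k)

  InDiff-neg : ∀ {k} → InDiff ℓ L U R k → InDiff ℓ L U R (ℤ.- k)
  InDiff-neg (i , j , i∈A , j∈A , i-j≡k) = j , i , j∈A , i∈A , trans (sym (-[i-j]≡j-i (ℤ.+ toℕ i) (ℤ.+ toℕ j))) (cong ℤ.-_ i-j≡k)

  L⊆A : ∀ {a} → χ L a ≡ true → InAℕ a
  L⊆A a∈L with χ-true L a∈L
  ... | i , i≡a , i∈L = i , i≡a , inj₁ i∈L

  U⊆A : ∀ {a} → χ U a ≡ true → InAℕ a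
  U⊆A a∈U with χ-true U a∈U
  ... | i , i≡a , i∈U = i , i≡a , inj₂ (inj₁ i∈U)

  R⊆A : ℓ + m ≤ n → ∀ {p} → χ R p ≡ true → InAℕ (ℓ + p)
  R⊆A ℓ+m≤n p∈R with χ-true R p∈R
  ... | r , refl , r∈R = fromℕ< ℓ+r<n , toℕ-fromℕ< ℓ+r<n , inj₂ (inj₂ (r , r∈R , sym (toℕ-fromℕ< ℓ+r<n)))
    where
    ℓ+r<n : ℓ + toℕ r < n
    ℓ+r<n = <-≤-trans (+-monoʳ-< ℓ (toℕ<n r)) ℓ+m≤n

  covers : (∀ k → k ≤ m → InDiff ℓ L U R (ℤ.+ k)) → Covers ℓ L U R
  covers diff (ℤ.+ k)    k≤m = diff k k≤m
  covers diff -[1+ k ] k<m = InDiff-neg (diff (suc k) k<m)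

  ¬covers⇒gap : ¬ Covers ℓ L U R → ∃[ k ] k ≤ m × ¬ InDiff ℓ L U R (ℤ.+ k)
  ¬covers⇒gap ¬cov with ¬∀⟶∃¬ (suc m) (λ k → InDiff ℓ L U R (ℤ.+ toℕ k)) (λ k → InDiff? ℓ L U R (ℤ.+ toℕ k))
                          (λ diff → ¬cov (covers λ k k≤m → subst (λ x → InDiff ℓ L U R (ℤ.+ x)) (toℕ-fromℕ< (s≤s k≤m)) (diff (fromℕ< (s≤s k≤m)))))
  ... | k , gap = toℕ k , toℕ≤pred[n] k , gap

  module _ (ℓ+m≤n : ℓ + m ≤ n) {k : ℕ} (gap : ¬ InDiff ℓ L U R (ℤ.+ k)) where

    gap⇒diffFree≡1 : ∀ l → diffFree k l (χ R) ≡ 1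
    gap⇒diffFree≡1 l = disjointOn≡1 l λ p p∈R p+k∈R →
      gap (InDiff-+ (R⊆A ℓ+m≤n p∈R) (subst InAℕ (sym (+-assoc ℓ p k)) (subst (λ x → InAℕ (ℓ + x)) (+-comm k p) (R⊆A ℓ+m≤n p+k∈R))))

    gap⇒U-disjoint : ∀ {o j} → o ≡ ℓ + j + k → ∀ l → disjointOn l (χ U ∘ (o +_)) (χ R ∘ (j +_)) ≡ 1
    gap⇒U-disjoint {o} {j} o≡ l = disjointOn≡1 l λ q o+q∈U j+q∈R →
      gap (InDiff-+ (R⊆A ℓ+m≤n j+q∈R) (subst InAℕ (position q) (U⊆A o+q∈U)))
      where
      position : ∀ q → o + q ≡ ℓ + (j + q) + k
      position q = trans (cong (_+ q) o≡) (shuffle ℓ j k q)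
        where
        shuffle : ∀ ℓ j k q → ℓ + j + k + q ≡ ℓ + (j + q) + k
        shuffle = solve-∀

    gap⇒L-disjoint : ∀ {o} → ℓ + o ≡ k → ∀ l → disjointOn l (χ L) (χ R ∘ (o +_)) ≡ 1
    gap⇒L-disjoint {o} ℓ+o≡k l = disjointOn≡1 l λ q q∈L o+q∈R →
      gap (InDiff-+ (L⊆A q∈L) (subst InAℕ (position q) (R⊆A ℓ+m≤n o+q∈R)))
      where
      position : ∀ q → ℓ + (o + q) ≡ q + k
      position q = trans (shuffle ℓ o q) (cong (q +_) ℓ+o≡k)
        where
        shuffle : ∀ ℓ o q → ℓ + (o + q) ≡ q + (ℓ + o)
        shuffle = solve-∀

  diff-self : ∀ {a} → InAℕ a → InDiff ℓ L U R (ℤ.+ 0)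
  diff-self {a} a∈A = InDiff-+ a∈A (subst InAℕ (sym (+-identityʳ a)) a∈A)

  InDiff-0 : 1 ≤ ∣ L ∣ + ∣ U ∣ → InDiff ℓ L U R (ℤ.+ 0)
  InDiff-0 1≤s with nonempty? L
  ... | yes (i , i∈L) = diff-self (i , refl , inj₁ i∈L)
  ... | no  L≡∅       with 1≤∣p∣⇒nonempty U (subst (λ x → 1 ≤ x + ∣ U ∣) (trans (cong ∣_∣ (Empty-unique L≡∅)) (∣⊥∣≡0 n)) 1≤s)
  ...   | i , i∈U     = diff-self (i , refl , inj₂ (inj₁ i∈U))

-- The union bound

⌊n/2⌋+⌊n/2⌋≤n : ∀ n → ⌊ n /2⌋ + ⌊ n /2⌋ ≤ n
⌊n/2⌋+⌊n/2⌋≤n n = ≤-trans (+-monoʳ-≤ ⌊ n /2⌋ (⌊n/2⌋≤⌈n/2⌉ n)) (≤-reflexive (⌊n/2⌋+⌈n/2⌉≡n n))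

n≤1+⌊n/2⌋+⌊n/2⌋ : ∀ n → n ≤ suc (⌊ n /2⌋ + ⌊ n /2⌋)
n≤1+⌊n/2⌋+⌊n/2⌋ zero          = z≤n
n≤1+⌊n/2⌋+⌊n/2⌋ (suc zero)    = s≤s z≤n
n≤1+⌊n/2⌋+⌊n/2⌋ (suc (suc n)) = s≤s (≤-trans (s≤s (n≤1+⌊n/2⌋+⌊n/2⌋ n)) (≤-reflexive (cong suc (sym (+-suc ⌊ n /2⌋ ⌊ n /2⌋)))))

module UnionBound (n ℓ u : ℕ) (4[ℓ+u]≤n : 4 * (ℓ + u) ≤ n) (L U : Subset n)
  (L-low : ∀ i → i ∈ L → toℕ i < ℓ) (U-high : ∀ i → i ∈ U → n ∸ u ≤ toℕ i) where

  m = n ∸ ℓ ∸ u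
  half = ⌊ n /2⌋
  s = ∣ L ∣ + ∣ U ∣

  ℓ+u≤n : ℓ + u ≤ n
  ℓ+u≤n = ≤-trans (m≤n*m (ℓ + u) 4) 4[ℓ+u]≤n

  n≡ℓ+m+u : n ≡ ℓ + m + u
  n≡ℓ+m+u = begin
    n                       ≡⟨ m+[n∸m]≡n ℓ+u≤n ⟨
    ℓ + u + (n ∸ (ℓ + u))   ≡⟨ cong (ℓ + u +_) (∸-+-assoc n ℓ u) ⟨
    ℓ + u + m               ≡⟨ rearrange ℓ u m ⟩
    ℓ + m + u               ∎
    where
    open ≡-Reasoning
    rearrange : ∀ ℓ u m → ℓ + u + m ≡ ℓ + m + u
    rearrange = solve-∀

  ℓ+m≤n : ℓ + m ≤ n
  ℓ+m≤n = ≤-trans (m≤m+n (ℓ + m) u) (≤-reflexive (sym n≡ℓ+m+u))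

  n∸u≡ℓ+m : n ∸ u ≡ ℓ + m
  n∸u≡ℓ+m = trans (cong (_∸ u) n≡ℓ+m+u) (m+n∸n≡m (ℓ + m) u)

  3[ℓ+u]≤m : 3 * (ℓ + u) ≤ m
  3[ℓ+u]≤m = +-cancelʳ-≤ (ℓ + u) (3 * (ℓ + u)) m (begin
    3 * (ℓ + u) + (ℓ + u) ≡⟨ +-comm (3 * (ℓ + u)) (ℓ + u) ⟩
    4 * (ℓ + u)           ≤⟨ 4[ℓ+u]≤n ⟩
    n                     ≡⟨ n≡ℓ+m+u ⟩
    ℓ + m + u             ≡⟨ rearrange ℓ m u ⟩
    m + (ℓ + u)           ∎)
    where
    open ≤-Reasoning
    rearrange : ∀ ℓ m u → ℓ + m + u ≡ m + (ℓ + u)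
    rearrange = solve-∀

  k≤n/2⇒3k≤2m : ∀ {k} → k ≤ half → 3 * k ≤ 2 * m
  k≤n/2⇒3k≤2m {k} k≤half = *-cancelˡ-≤ 2 (begin
    2 * (3 * k)             ≡⟨ rearrange k ⟩
    3 * (k + k)             ≤⟨ *-monoʳ-≤ 3 (≤-trans (+-mono-≤ k≤half k≤half) (⌊n/2⌋+⌊n/2⌋≤n n)) ⟩
    3 * n                   ≡⟨ cong (3 *_) n≡ℓ+m+u ⟩
    3 * (ℓ + m + u)         ≡⟨ rearrange′ ℓ m u ⟩
    3 * m + 3 * (ℓ + u)     ≤⟨ +-monoʳ-≤ (3 * m) 3[ℓ+u]≤m ⟩
    3 * m + m               ≡⟨ rearrange″ m ⟩
    2 * (2 * m)             ∎)
    where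
    open ≤-Reasoning
    rearrange : ∀ k → 2 * (3 * k) ≡ 3 * (k + k)
    rearrange = solve-∀
    rearrange′ : ∀ ℓ m u → 3 * (ℓ + m + u) ≡ 3 * m + 3 * (ℓ + u)
    rearrange′ = solve-∀
    rearrange″ : ∀ m → 3 * m + m ≡ 2 * (2 * m)
    rearrange″ = solve-∀

  j<m∸n/2⇒2j+ℓ+u≤m : ∀ {j} → j < m ∸ half → j + j + (ℓ + u) ≤ m
  j<m∸n/2⇒2j+ℓ+u≤m {j} j<m∸half = +-cancelʳ-≤ m (j + j + (ℓ + u)) m (<⇒≤ (begin-strict
    j + j + (ℓ + u) + m           ≡⟨ rearrange j ℓ u m ⟩
    j + j + (ℓ + m + u)           ≡⟨ cong (j + j +_) n≡ℓ+m+u ⟨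
    j + j + n                     ≤⟨ +-monoʳ-≤ (j + j) (n≤1+⌊n/2⌋+⌊n/2⌋ n) ⟩
    j + j + suc (half + half)     <⟨ n<1+n _ ⟩
    suc (j + j + suc (half + half)) ≡⟨ rearrange′ j half ⟩
    (suc j + half) + (suc j + half) ≤⟨ +-mono-≤ 1+j+half≤m 1+j+half≤m ⟩
    m + m                         ∎))
    where
    open ≤-Reasoning
    1+j+half≤m : suc j + half ≤ m
    1+j+half≤m = m≤o∸n⇒m+n≤o (suc j) (<⇒≤ (m∸n≢0⇒n<m λ m∸half≡0 → n≮0 (subst (j <_) m∸half≡0 j<m∸half))) j<m∸half
    rearrange : ∀ j ℓ u m → j + j + (ℓ + u) + m ≡ j + j + (ℓ + m + u)
    rearrange = solve-∀
    rearrange′ : ∀ j h → suc (j + j + suc (h + h)) ≡ (suc j + h) + (suc j + h)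
    rearrange′ = solve-∀

  U-shifted : ℕ → Bool
  U-shifted = χ U ∘ (n ∸ u +_)

  -- For the gap k = m ∸ j, the witnesses of k ∈ A − A inside R, in U × R and in R × L lie in
  -- disjoint windows of R: pairs (q, k + q) for q < j, then j + [0, u) and k ∸ ℓ + [0, ℓ).
  crossFree : ℕ → (ℕ → Bool) → ℕ
  crossFree j ρ = diffFree (m ∸ j) j ρ * (disjointOn u U-shifted (ρ ∘ (j +_)) * disjointOn ℓ (χ L) (ρ ∘ (m ∸ j ∸ ℓ +_)))

  gapWeight : Subset m → ℕ
  gapWeight R = ∑< half (λ i → diffFree (suc i) m (χ R)) + ∑< (m ∸ half) (λ j → crossFree j (χ R))

  gap⇒gapWeight : ∀ R {k} → suc k ≤ m → ¬ InDiff ℓ L U R (ℤ.+ suc k) → 1 ≤ gapWeight R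
  gap⇒gapWeight R {k} K≤m gap with suc k ≤? half
  ... | yes K≤half = ≤-trans (≤-reflexive (sym (gap⇒diffFree≡1 ℓ L U R ℓ+m≤n gap m)))
                       (≤-trans (∑<-≥ half _ K≤half) (m≤m+n _ _))
  ... | no  K≰half = ≤-trans (≤-reflexive (sym crossFree≡1)) (≤-trans (∑<-≥ (m ∸ half) _ j<m∸half) (m≤n+m _ _))
    where
    K = suc k
    j = m ∸ K
    j<m∸half : j < m ∸ half
    j<m∸half = ∸-monoʳ-< (≰⇒> K≰half) K≤m
    j+K≡m : j + K ≡ m
    j+K≡m = m∸n+n≡m K≤m
    m∸j≡K : m ∸ j ≡ K
    m∸j≡K = m∸[m∸n]≡n K≤m
    ℓ≤K : ℓ ≤ K
    ℓ≤K = ≤-trans (m≤m+n ℓ u) (≤-trans (m≤n+m (ℓ + u) j) (+-cancelˡ-≤ j (j + (ℓ + u)) K (begin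
      j + (j + (ℓ + u)) ≡⟨ +-assoc j j (ℓ + u) ⟨
      j + j + (ℓ + u)   ≤⟨ j<m∸n/2⇒2j+ℓ+u≤m j<m∸half ⟩
      m                 ≡⟨ j+K≡m ⟨
      j + K             ∎)))
      where open ≤-Reasoning
    crossFree≡1 : crossFree j (χ R) ≡ 1
    crossFree≡1 = cong₂ _*_
      (subst (λ K′ → diffFree K′ j (χ R) ≡ 1) (sym m∸j≡K) (gap⇒diffFree≡1 ℓ L U R ℓ+m≤n gap j))
      (cong₂ _*_
        (gap⇒U-disjoint ℓ L U R ℓ+m≤n gap (trans n∸u≡ℓ+m (trans (cong (ℓ +_) (sym j+K≡m)) (sym (+-assoc ℓ j K)))) u)
        (gap⇒L-disjoint ℓ L U R ℓ+m≤n gap (trans (cong (ℓ +_) (cong (_∸ ℓ) m∸j≡K)) (m+[n∸m]≡n ℓ≤K)) ℓ))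

  uncovered⇒gapWeight : 1 ≤ s → ∀ R → ¬ Covers ℓ L U R → 1 ≤ gapWeight R
  uncovered⇒gapWeight 1≤s R uncovered with ¬covers⇒gap ℓ L U R uncovered
  ... | suc k , K≤m , gap = gap⇒gapWeight R K≤m gap
  ... | zero  , _   , gap = contradiction (InDiff-0 ℓ L U R 1≤s) gap

  s≡countTrue : s ≡ countTrue u U-shifted + countTrue ℓ (χ L)
  s≡countTrue = trans (cong₂ _+_ ∣L∣≡ ∣U∣≡) (+-comm (countTrue ℓ (χ L)) _)
    where
    ∣L∣≡ : ∣ L ∣ ≡ countTrue ℓ (χ L)
    ∣L∣≡ = ∣p∣≡countTrue-window L 0 ℓ (sym (m+[n∸m]≡n (≤-trans (m≤m+n ℓ u) ℓ+u≤n))) (λ i i∈L → z≤n , L-low i i∈L)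
    n≡n∸u+u : n ≡ n ∸ u + u
    n≡n∸u+u = sym (m∸n+n≡m (≤-trans (m≤n+m u ℓ) ℓ+u≤n))
    ∣U∣≡ : ∣ U ∣ ≡ countTrue u U-shifted
    ∣U∣≡ = ∣p∣≡countTrue-window U (n ∸ u) u (trans n≡n∸u+u (cong (n ∸ u +_) (sym (+-identityʳ u))))
             (λ i i∈U → U-high i i∈U , subst (toℕ i <_) n≡n∸u+u (toℕ<n i))

  crossFree-exact : ∀ j → j < m ∸ half → ∑ₛ m (λ R → crossFree j (χ R)) * 4 ^ j * 2 ^ s ≡ 3 ^ j * 2 ^ m
  crossFree-exact j j<m∸half rewrite s≡countTrue = crossFree-count j u M ℓ U-shifted (χ L) m≡ m∸j≡ m∸j∸ℓ≡
    where
    M = m ∸ (j + j + (ℓ + u))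
    m≡ : m ≡ j + ((u + (M + ℓ)) + j)
    m≡ = trans (sym (m+[n∸m]≡n (j<m∸n/2⇒2j+ℓ+u≤m j<m∸half))) (rearrange j ℓ u M)
      where
      rearrange : ∀ j ℓ u M → j + j + (ℓ + u) + M ≡ j + ((u + (M + ℓ)) + j)
      rearrange = solve-∀
    m∸j≡ : m ∸ j ≡ j + (u + (M + ℓ))
    m∸j≡ = trans (cong (_∸ j) m≡) (trans (m+n∸m≡n j _) (+-comm (u + (M + ℓ)) j))
    m∸j∸ℓ≡ : m ∸ j ∸ ℓ ≡ j + (u + M)
    m∸j∸ℓ≡ = trans (cong (_∸ ℓ) (trans m∸j≡ (rearrange j u M ℓ))) (m+n∸m≡n ℓ _)
      where
      rearrange : ∀ j u M ℓ → j + (u + (M + ℓ)) ≡ ℓ + (j + (u + M))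
      rearrange = solve-∀

  shortGaps longGaps : ℕ
  shortGaps = ∑< half (λ i → diffFreeCount (suc i) m)
  longGaps  = ∑< (m ∸ half) (λ j → ∑ₛ m (λ R → crossFree j (χ R)))

  badCount≤gaps : 1 ≤ s → badCount n ℓ m L U ≤ shortGaps + longGaps
  badCount≤gaps 1≤s = begin
    badCount n ℓ m L U         ≤⟨ ∑ₛ-mono-≤ m indicator≤gapWeight ⟩
    ∑ₛ m gapWeight             ≡⟨ ∑ₛ-distrib-+ m _ _ ⟩
    ∑ₛ m (λ R → ∑< half (λ i → diffFree (suc i) m (χ R))) + ∑ₛ m (λ R → ∑< (m ∸ half) (λ j → crossFree j (χ R)))
                               ≡⟨ cong₂ _+_ (∑ₛ-∑< m half _) (∑ₛ-∑< m (m ∸ half) _) ⟩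
    shortGaps + longGaps       ∎
    where
    open ≤-Reasoning
    indicator≤gapWeight : ∀ R → [ ¬? (Covers? ℓ L U R) ] ≤ gapWeight R
    indicator≤gapWeight R with Covers? ℓ L U R
    ... | yes _         = z≤n
    ... | no  uncovered = uncovered⇒gapWeight 1≤s R uncovered

  longGaps-bound : longGaps * 2 ^ s < 4 * 2 ^ m
  longGaps-bound = ∑<-geometric-< (m ∸ half) _ (2 ^ s) (2 ^ m) (m^n>0 2 m) (λ j j< → ≤-reflexive (crossFree-exact j j<))

  shortGaps-bound : shortGaps ^ 3 ≤ half ^ 3 * (3 ^ m * 2 ^ m)
  shortGaps-bound = ∑<-^3 half _ _ (λ i i<half → diffFreeCount-cube {m = m} (s≤s z≤n) (k≤n/2⇒3k≤2m i<half))

  -- Without L ∪ U even 0 may be missing from A − A; then the trivial split suffices, as 1 − 4 / 2^0 < 0.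
  badCount-split : ∃[ Xs ] ∃[ Xl ] badCount n ℓ m L U ≤ Xs + Xl × Xl * 2 ^ s < 4 * 2 ^ m × Xs ^ 3 ≤ half ^ 3 * (3 ^ m * 2 ^ m)
  badCount-split with 1 ≤? s
  ... | yes 1≤s = shortGaps , longGaps , badCount≤gaps 1≤s , longGaps-bound , shortGaps-bound
  ... | no  1≰s = 0 , badCount n ℓ m L U , ≤-refl , (begin-strict
    badCount n ℓ m L U * 2 ^ s ≡⟨ cong (λ x → badCount n ℓ m L U * 2 ^ x) (n<1⇒n≡0 (≰⇒> 1≰s)) ⟩
    badCount n ℓ m L U * 1     ≡⟨ *-identityʳ _ ⟩
    badCount n ℓ m L U         ≤⟨ ≤-trans (m≤n+m _ _) (≤-reflexive (goodCount+badCount n ℓ m L U)) ⟩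
    2 ^ m                      <⟨ m<m+n (2 ^ m) (*-mono-≤ (s≤s (z≤n {2})) (m^n>0 2 m)) ⟩
    4 * 2 ^ m                  ∎) , z≤n
    where open ≤-Reasoning

-- Rational arithmetic

ι : ℕ → ℚ
ι a = ℤ.+ a / 1

toℚᵘ-ι : ∀ a → toℚᵘ (ι a) ≡ ℚᵘ.mkℚᵘ (ℤ.+ a) 0
toℚᵘ-ι a = cong toℚᵘ (ℚ.normalize-coprime (coprime-sym (1-coprimeTo a)))

ι-+ : ∀ a b → ι (a ℕ.+ b) ≡ ι a ℚ.+ ι b
ι-+ a b = ℚ.toℚᵘ-injective (begin
  toℚᵘ (ι (a ℕ.+ b))                              ≈⟨ ℚᵘ.≃-reflexive (toℚᵘ-ι (a ℕ.+ b)) ⟩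
  ℚᵘ.mkℚᵘ (ℤ.+ (a ℕ.+ b)) 0                       ≈⟨ ℚᵘ.*≡* (cong (ℤ._* ℤ.+ 1) (trans (ℤ.pos-+ a b) (sym (cong₂ ℤ._+_ (ℤ.*-identityʳ (ℤ.+ a)) (ℤ.*-identityʳ (ℤ.+ b)))))) ⟩
  ℚᵘ.mkℚᵘ (ℤ.+ a) 0 ℚᵘ.+ ℚᵘ.mkℚᵘ (ℤ.+ b) 0        ≈⟨ ℚᵘ.≃-reflexive (cong₂ ℚᵘ._+_ (toℚᵘ-ι a) (toℚᵘ-ι b)) ⟨
  toℚᵘ (ι a) ℚᵘ.+ toℚᵘ (ι b)                      ≈⟨ ℚ.toℚᵘ-homo-+ (ι a) (ι b) ⟨
  toℚᵘ (ι a ℚ.+ ι b)                              ∎)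
  where open ℚᵘ.≃-Reasoning

ι-* : ∀ a b → ι (a ℕ.* b) ≡ ι a ℚ.* ι b
ι-* a b = ℚ.toℚᵘ-injective (begin
  toℚᵘ (ι (a ℕ.* b))                              ≈⟨ ℚᵘ.≃-reflexive (toℚᵘ-ι (a ℕ.* b)) ⟩
  ℚᵘ.mkℚᵘ (ℤ.+ (a ℕ.* b)) 0                       ≈⟨ ℚᵘ.*≡* (cong (ℤ._* ℤ.+ 1) (ℤ.pos-* a b)) ⟩
  ℚᵘ.mkℚᵘ (ℤ.+ a) 0 ℚᵘ.* ℚᵘ.mkℚᵘ (ℤ.+ b) 0        ≈⟨ ℚᵘ.≃-reflexive (cong₂ ℚᵘ._*_ (toℚᵘ-ι a) (toℚᵘ-ι b)) ⟨
  toℚᵘ (ι a) ℚᵘ.* toℚᵘ (ι b)                      ≈⟨ ℚ.toℚᵘ-homo-* (ι a) (ι b) ⟨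
  toℚᵘ (ι a ℚ.* ι b)                              ∎)
  where open ℚᵘ.≃-Reasoning

ι-mono-≤ : ∀ {a b} → a ≤ b → ι a ℚ.≤ ι b
ι-mono-≤ {a} {b} a≤b = ℚ.toℚᵘ-cancel-≤ (subst₂ ℚᵘ._≤_ (sym (toℚᵘ-ι a)) (sym (toℚᵘ-ι b))
  (ℚᵘ.*≤* (subst₂ ℤ._≤_ (sym (ℤ.*-identityʳ _)) (sym (ℤ.*-identityʳ _)) (ℤ.+≤+ a≤b))))

ι-mono-< : ∀ {a b} → a < b → ι a ℚ.< ι b
ι-mono-< {a} {b} a<b = ℚ.toℚᵘ-cancel-< (subst₂ ℚᵘ._<_ (sym (toℚᵘ-ι a)) (sym (toℚᵘ-ι b))
  (ℚᵘ.*<* (subst₂ ℤ._<_ (sym (ℤ.*-identityʳ _)) (sym (ℤ.*-identityʳ _)) (ℤ.+<+ a<b))))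

ι-nonNeg : ∀ a → 0ℚ ℚ.≤ ι a
ι-nonNeg a = ι-mono-≤ (z≤n {a})

ι-^ : ∀ a k → ι (a ^ k) ≡ ι a ^ℚ k
ι-^ a zero    = refl
ι-^ a (suc k) = trans (ι-* a (a ^ k)) (cong (ι a ℚ.*_) (ι-^ a k))

^ℚ-distrib-* : ∀ a b k → (a ℚ.* b) ^ℚ k ≡ a ^ℚ k ℚ.* b ^ℚ k
^ℚ-distrib-* a b zero    = refl
^ℚ-distrib-* a b (suc k) = trans (cong (a ℚ.* b ℚ.*_) (^ℚ-distrib-* a b k))
  (solve 4 (λ a b x y → (a :* b) :* (x :* y) := (a :* x) :* (b :* y)) refl a b (a ^ℚ k) (b ^ℚ k))

ι[2^k]*½^k≡1 : ∀ k → ι (2 ^ k) ℚ.* ½ ^ℚ k ≡ 1ℚ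
ι[2^k]*½^k≡1 zero    = refl
ι[2^k]*½^k≡1 (suc k) = begin
  ι (2 ℕ.* 2 ^ k) ℚ.* (½ ℚ.* ½ ^ℚ k)      ≡⟨ cong (ℚ._* (½ ℚ.* ½ ^ℚ k)) (ι-* 2 (2 ^ k)) ⟩
  ι 2 ℚ.* ι (2 ^ k) ℚ.* (½ ℚ.* ½ ^ℚ k)    ≡⟨ solve 4 (λ a b c d → a :* b :* (c :* d) := (a :* c) :* (b :* d)) refl (ι 2) (ι (2 ^ k)) ½ (½ ^ℚ k) ⟩
  ι 2 ℚ.* ½ ℚ.* (ι (2 ^ k) ℚ.* ½ ^ℚ k)    ≡⟨ cong (ι 2 ℚ.* ½ ℚ.*_) (ι[2^k]*½^k≡1 k) ⟩
  ι 2 ℚ.* ½ ℚ.* 1ℚ                        ≡⟨⟩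
  1ℚ                                      ∎
  where open ≡-Reasoning

½^k>0 : ∀ k → 0ℚ ℚ.< ½ ^ℚ k
½^k>0 zero    = ℚ.*<* (ℤ.+<+ (s≤s z≤n))
½^k>0 (suc k) = ℚ.positive⁻¹ (½ ℚ.* ½ ^ℚ k) {{ℚ.pos*pos⇒pos ½ (½ ^ℚ k) {{ℚ.positive (½^k>0 k)}}}}

[n/2]≡ι[n]*½ : ∀ n → ℤ.+ n / 2 ≡ ι n ℚ.* ½
[n/2]≡ι[n]*½ n = ℚ.toℚᵘ-injective (begin
  toℚᵘ (ℤ.+ n / 2)            ≈⟨ ℚ.toℚᵘ-fromℚᵘ (ℚᵘ.mkℚᵘ (ℤ.+ n) 1) ⟩
  ℚᵘ.mkℚᵘ (ℤ.+ n) 1                  ≈⟨ ℚᵘ.*≡* (cong (ℤ._* ℤ.+ 2) (ℤ.*-identityʳ (ℤ.+ n))) ⟨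
  ℚᵘ.mkℚᵘ (ℤ.+ n) 0 ℚᵘ.* toℚᵘ ½      ≈⟨ ℚᵘ.≃-reflexive (cong (ℚᵘ._* toℚᵘ ½) (toℚᵘ-ι n)) ⟨
  toℚᵘ (ι n) ℚᵘ.* toℚᵘ ½             ≈⟨ ℚ.toℚᵘ-homo-* (ι n) ½ ⟨
  toℚᵘ (ι n ℚ.* ½)            ∎)
  where open ℚᵘ.≃-Reasoning

nonNeg-* : ∀ {a b} → 0ℚ ℚ.≤ a → 0ℚ ℚ.≤ b → 0ℚ ℚ.≤ a ℚ.* b
nonNeg-* {a} {b} 0≤a 0≤b = ℚ.nonNegative⁻¹ (a ℚ.* b) {{ℚ.nonNeg*nonNeg⇒nonNeg a {{ℚ.nonNegative 0≤a}} b {{ℚ.nonNegative 0≤b}}}}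

ℚ-*-monoʳ-≤ : ∀ {p q} r → 0ℚ ℚ.≤ r → p ℚ.≤ q → p ℚ.* r ℚ.≤ q ℚ.* r
ℚ-*-monoʳ-≤ r 0≤r = ℚ.*-monoʳ-≤-nonNeg r {{ℚ.nonNegative 0≤r}}

ℚ-*-monoˡ-≤ : ∀ {p q} r → 0ℚ ℚ.≤ r → p ℚ.≤ q → r ℚ.* p ℚ.≤ r ℚ.* q
ℚ-*-monoˡ-≤ r 0≤r = ℚ.*-monoˡ-≤-nonNeg r {{ℚ.nonNegative 0≤r}}

ℚ-*-monoʳ-< : ∀ {p q} r → 0ℚ ℚ.< r → p ℚ.< q → p ℚ.* r ℚ.< q ℚ.* r
ℚ-*-monoʳ-< r 0<r = ℚ.*-monoˡ-<-pos r {{ℚ.positive 0<r}}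

^3≡ : ∀ a → a ^ℚ 3 ≡ a ℚ.* (a ℚ.* a)
^3≡ a = cong (λ x → a ℚ.* (a ℚ.* x)) (ℚ.*-identityʳ a)

^3-mono-≤ : ∀ {a b} → 0ℚ ℚ.≤ a → a ℚ.≤ b → a ^ℚ 3 ℚ.≤ b ^ℚ 3
^3-mono-≤ {a} {b} 0≤a a≤b = begin
  a ^ℚ 3          ≡⟨ ^3≡ a ⟩
  a ℚ.* (a ℚ.* a) ≤⟨ ℚ-*-monoʳ-≤ (a ℚ.* a) (nonNeg-* 0≤a 0≤a) a≤b ⟩
  b ℚ.* (a ℚ.* a) ≤⟨ ℚ-*-monoˡ-≤ b 0≤b (ℚ-*-monoʳ-≤ a 0≤a a≤b) ⟩
  b ℚ.* (b ℚ.* a) ≤⟨ ℚ-*-monoˡ-≤ b 0≤b (ℚ-*-monoˡ-≤ b 0≤b a≤b) ⟩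
  b ℚ.* (b ℚ.* b) ≡⟨ ^3≡ b ⟨
  b ^ℚ 3          ∎
  where
  open ℚ.≤-Reasoning
  0≤b = ℚ.≤-trans 0≤a a≤b

^3-mono-< : ∀ {a b} → a ℚ.< b → 0ℚ ℚ.≤ b → a ^ℚ 3 ℚ.< b ^ℚ 3
^3-mono-< {a} {b} a<b 0≤b with a ℚ.<? 0ℚ
... | yes a<0 = ℚ.<-≤-trans a³<0 (^3-mono-≤ (ℚ.≤-refl {0ℚ}) 0≤b)
  where
  a³<0 : a ^ℚ 3 ℚ.< 0ℚ
  a³<0 = subst (ℚ._< 0ℚ) (sym (^3≡ a)) (ℚ.negative⁻¹ (a ℚ.* (a ℚ.* a))
           {{ℚ.neg*pos⇒neg a {{ℚ.negative a<0}} (a ℚ.* a) {{ℚ.neg*neg⇒pos a {{ℚ.negative a<0}} a {{ℚ.negative a<0}}}}}})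
... | no  a≮0 = begin-strict
  a ^ℚ 3          ≡⟨ ^3≡ a ⟩
  a ℚ.* (a ℚ.* a) ≤⟨ ℚ-*-monoˡ-≤ a 0≤a (ℚ-*-monoˡ-≤ a 0≤a (ℚ.<⇒≤ a<b)) ⟩
  a ℚ.* (a ℚ.* b) ≤⟨ ℚ-*-monoˡ-≤ a 0≤a (ℚ-*-monoʳ-≤ b 0≤b (ℚ.<⇒≤ a<b)) ⟩
  a ℚ.* (b ℚ.* b) <⟨ ℚ-*-monoʳ-< (b ℚ.* b) 0<b² a<b ⟩
  b ℚ.* (b ℚ.* b) ≡⟨ ^3≡ b ⟨
  b ^ℚ 3          ∎
  where
  open ℚ.≤-Reasoning
  0≤a = ℚ.≮⇒≥ a≮0
  0<b = ℚ.≤-<-trans 0≤a a<b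
  0<b² : 0ℚ ℚ.< b ℚ.* b
  0<b² = ℚ.positive⁻¹ (b ℚ.* b) {{ℚ.pos*pos⇒pos b {{ℚ.positive 0<b}} b {{ℚ.positive 0<b}}}}

1-4/2ˢ-G/2ᵐ<Xs/2ᵐ : ∀ m s G B Xs Xl → G ℕ.+ B ≡ 2 ^ m → B ≤ Xs ℕ.+ Xl → Xl ℕ.* 2 ^ s < 4 ℕ.* 2 ^ m →
  (1ℚ ℚ.- (ℤ.+ 4 / 1) ℚ.* ½ ^ℚ s) ℚ.- (ℤ.+ G / 1) ℚ.* ½ ^ℚ m ℚ.< ι Xs ℚ.* ½ ^ℚ m
1-4/2ˢ-G/2ᵐ<Xs/2ᵐ m s G B Xs Xl G+B≡2^m B≤Xs+Xl Xl-bound = begin-strict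
  (1ℚ ℚ.- ι 4 ℚ.* Hs) ℚ.- ι G ℚ.* H
    ≡⟨ solve 5 (λ g b h hs f → (con 1ℚ :- f :* hs) :- g :* h := (b :* h :- f :* hs) :+ (con 1ℚ :- (g :+ b) :* h)) refl (ι G) (ι B) H Hs (ι 4) ⟩
  (ι B ℚ.* H ℚ.- ι 4 ℚ.* Hs) ℚ.+ (1ℚ ℚ.- (ι G ℚ.+ ι B) ℚ.* H)
    ≡⟨ cong (λ x → (ι B ℚ.* H ℚ.- ι 4 ℚ.* Hs) ℚ.+ (1ℚ ℚ.- x)) (trans (cong (ℚ._* H) (trans (sym (ι-+ G B)) (cong ι G+B≡2^m))) (ι[2^k]*½^k≡1 m)) ⟩
  (ι B ℚ.* H ℚ.- ι 4 ℚ.* Hs) ℚ.+ 0ℚ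
    ≡⟨ ℚ.+-identityʳ _ ⟩
  ι B ℚ.* H ℚ.- ι 4 ℚ.* Hs
    ≤⟨ ℚ.+-monoˡ-≤ (ℚ.- (ι 4 ℚ.* Hs)) (ℚ-*-monoʳ-≤ H (ℚ.<⇒≤ (½^k>0 m)) (subst (ι B ℚ.≤_) (ι-+ Xs Xl) (ι-mono-≤ B≤Xs+Xl))) ⟩
  (ι Xs ℚ.+ ι Xl) ℚ.* H ℚ.- ι 4 ℚ.* Hs
    ≡⟨ solve 4 (λ a b h f → (a :+ b) :* h :- f := a :* h :+ (b :* h :- f)) refl (ι Xs) (ι Xl) H (ι 4 ℚ.* Hs) ⟩
  ι Xs ℚ.* H ℚ.+ (ι Xl ℚ.* H ℚ.- ι 4 ℚ.* Hs)
    <⟨ ℚ.+-monoʳ-< (ι Xs ℚ.* H) (subst (ι Xl ℚ.* H ℚ.- ι 4 ℚ.* Hs ℚ.<_) (ℚ.+-inverseʳ (ι 4 ℚ.* Hs)) (ℚ.+-monoˡ-< (ℚ.- (ι 4 ℚ.* Hs)) long)) ⟩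
  ι Xs ℚ.* H ℚ.+ 0ℚ
    ≡⟨ ℚ.+-identityʳ _ ⟩
  ι Xs ℚ.* H ∎
  where
  open ℚ.≤-Reasoning
  H = ½ ^ℚ m
  Hs = ½ ^ℚ s
  long : ι Xl ℚ.* H ℚ.< ι 4 ℚ.* Hs
  long = begin-strict
    ι Xl ℚ.* H                              ≡⟨ solve 2 (λ a h → a :* h := a :* h :* con 1ℚ) refl (ι Xl) H ⟩
    ι Xl ℚ.* H ℚ.* 1ℚ                       ≡⟨ cong (ι Xl ℚ.* H ℚ.*_) (ι[2^k]*½^k≡1 s) ⟨
    ι Xl ℚ.* H ℚ.* (ι (2 ^ s) ℚ.* Hs)       ≡⟨ solve 4 (λ a h t hs → a :* h :* (t :* hs) := a :* t :* (h :* hs)) refl (ι Xl) H (ι (2 ^ s)) Hs ⟩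
    ι Xl ℚ.* ι (2 ^ s) ℚ.* (H ℚ.* Hs)       <⟨ ℚ-*-monoʳ-< (H ℚ.* Hs) (ℚ.positive⁻¹ (H ℚ.* Hs) {{ℚ.pos*pos⇒pos H {{ℚ.positive (½^k>0 m)}} Hs {{ℚ.positive (½^k>0 s)}}}})
                                                 (subst₂ ℚ._<_ (ι-* Xl (2 ^ s)) (ι-* 4 (2 ^ m)) (ι-mono-< Xl-bound)) ⟩
    ι 4 ℚ.* ι (2 ^ m) ℚ.* (H ℚ.* Hs)        ≡⟨ solve 4 (λ f t h hs → f :* t :* (h :* hs) := f :* hs :* (t :* h)) refl (ι 4) (ι (2 ^ m)) H Hs ⟩
    ι 4 ℚ.* Hs ℚ.* (ι (2 ^ m) ℚ.* H)        ≡⟨ cong (ι 4 ℚ.* Hs ℚ.*_) (ι[2^k]*½^k≡1 m) ⟩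
    ι 4 ℚ.* Hs ℚ.* 1ℚ                       ≡⟨ ℚ.*-identityʳ _ ⟩
    ι 4 ℚ.* Hs                              ∎

[Xs/2ᵐ]³≤[n/2]³[3/4]ᵐ : ∀ n m Xs K → Xs ^ 3 ≤ K ^ 3 ℕ.* (3 ^ m ℕ.* 2 ^ m) → K ℕ.+ K ≤ n →
  (ι Xs ℚ.* ½ ^ℚ m) ^ℚ 3 ℚ.≤ (ℤ.+ n / 2) ^ℚ 3 ℚ.* (ℤ.+ 3 / 4) ^ℚ m
[Xs/2ᵐ]³≤[n/2]³[3/4]ᵐ n m Xs K Xs³≤ 2K≤n = begin
  (ι Xs ℚ.* H) ^ℚ 3
    ≡⟨ ^ℚ-distrib-* (ι Xs) H 3 ⟩
  ι Xs ^ℚ 3 ℚ.* H ^ℚ 3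
    ≡⟨ cong (ℚ._* H ^ℚ 3) (ι-^ Xs 3) ⟨
  ι (Xs ^ 3) ℚ.* H ^ℚ 3
    ≤⟨ ℚ-*-monoʳ-≤ (H ^ℚ 3) (^3-mono-≤ (ℚ.≤-refl {0ℚ}) 0≤H) (ι-mono-≤ Xs³≤) ⟩
  ι (K ^ 3 ℕ.* (3 ^ m ℕ.* 2 ^ m)) ℚ.* H ^ℚ 3
    ≡⟨ cong (ℚ._* H ^ℚ 3) (trans (ι-* (K ^ 3) _) (cong₂ ℚ._*_ (ι-^ K 3) (ι-* (3 ^ m) (2 ^ m)))) ⟩
  ι K ^ℚ 3 ℚ.* (ι (3 ^ m) ℚ.* ι (2 ^ m)) ℚ.* H ^ℚ 3
    ≡⟨ solve 4 (λ k a t h → k :* (a :* t) :* (h :* (h :* (h :* con 1ℚ))) := k :* (a :* h :* h) :* (t :* h)) refl (ι K ^ℚ 3) (ι (3 ^ m)) (ι (2 ^ m)) H ⟩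
  ι K ^ℚ 3 ℚ.* (ι (3 ^ m) ℚ.* H ℚ.* H) ℚ.* (ι (2 ^ m) ℚ.* H)
    ≡⟨ trans (cong (ι K ^ℚ 3 ℚ.* (ι (3 ^ m) ℚ.* H ℚ.* H) ℚ.*_) (ι[2^k]*½^k≡1 m)) (ℚ.*-identityʳ _) ⟩
  ι K ^ℚ 3 ℚ.* (ι (3 ^ m) ℚ.* H ℚ.* H)
    ≤⟨ ℚ-*-monoʳ-≤ _ (nonNeg-* (nonNeg-* (ι-nonNeg (3 ^ m)) 0≤H) 0≤H) (^3-mono-≤ (ι-nonNeg K) K≤n/2) ⟩
  (ι n ℚ.* ½) ^ℚ 3 ℚ.* (ι (3 ^ m) ℚ.* H ℚ.* H)
    ≡⟨ cong₂ ℚ._*_ (cong (_^ℚ 3) ([n/2]≡ι[n]*½ n)) [3/4]^m≡ ⟨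
  (ℤ.+ n / 2) ^ℚ 3 ℚ.* (ℤ.+ 3 / 4) ^ℚ m ∎
  where
  open ℚ.≤-Reasoning
  H = ½ ^ℚ m
  0≤H : 0ℚ ℚ.≤ H
  0≤H = ℚ.<⇒≤ (½^k>0 m)
  K≤n/2 : ι K ℚ.≤ ι n ℚ.* ½
  K≤n/2 = ℚ.≤-trans (ℚ.≤-reflexive (solve 1 (λ k → k := (k :+ k) :* con ½) refl (ι K)))
            (ℚ-*-monoʳ-≤ ½ (ℚ.<⇒≤ (½^k>0 1)) (subst (ℚ._≤ ι n) (ι-+ K K) (ι-mono-≤ 2K≤n)))
  [3/4]^m≡ : (ℤ.+ 3 / 4) ^ℚ m ≡ ι (3 ^ m) ℚ.* H ℚ.* H
  [3/4]^m≡ = begin-equality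
    (ι 3 ℚ.* ½ ℚ.* ½) ^ℚ m        ≡⟨ ^ℚ-distrib-* (ι 3 ℚ.* ½) ½ m ⟩
    (ι 3 ℚ.* ½) ^ℚ m ℚ.* H        ≡⟨ cong (ℚ._* H) (^ℚ-distrib-* (ι 3) ½ m) ⟩
    ι 3 ^ℚ m ℚ.* H ℚ.* H          ≡⟨ cong (λ x → x ℚ.* H ℚ.* H) (ι-^ 3 m) ⟨
    ι (3 ^ m) ℚ.* H ℚ.* H         ∎

probability-bound : ∀ n m s G B Xs Xl K → G ℕ.+ B ≡ 2 ^ m → B ≤ Xs ℕ.+ Xl → Xl ℕ.* 2 ^ s < 4 ℕ.* 2 ^ m →
  Xs ^ 3 ≤ K ^ 3 ℕ.* (3 ^ m ℕ.* 2 ^ m) → K ℕ.+ K ≤ n →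
  LtTimes34PowThird ((1ℚ ℚ.- (ℤ.+ 4 / 1) ℚ.* ½ ^ℚ s) ℚ.- (ℤ.+ G / 1) ℚ.* ½ ^ℚ m) (ℤ.+ n / 2) m
probability-bound n m s G B Xs Xl K G+B≡2^m B≤Xs+Xl Xl-bound Xs-bound K+K≤n = ℚ.<-≤-trans
  (^3-mono-< (1-4/2ˢ-G/2ᵐ<Xs/2ᵐ m s G B Xs Xl G+B≡2^m B≤Xs+Xl Xl-bound) (nonNeg-* (ι-nonNeg Xs) (ℚ.<⇒≤ (½^k>0 m))))
  ([Xs/2ᵐ]³≤[n/2]³[3/4]ᵐ n m Xs K Xs-bound K+K≤n)

-- Opened only here: an unqualified ℤ.+_ makes ℕ sections such as (k +_) ambiguous.
open import Data.Integer using (+_)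

proposition13 : (n ℓ u : ℕ) → 4 ℕ.* (ℓ ℕ.+ u) ≤ n →
    (L U : Subset n) →
    (∀ i → i ∈ L → toℕ i < ℓ) →
    (∀ i → i ∈ U → n ∸ u ≤ toℕ i) →
    LtTimes34PowThird
      ((1ℚ ℚ.- (+ 4 / 1) ℚ.* (½ ^ℚ (∣ L ∣ ℕ.+ ∣ U ∣)))
        ℚ.- (+ goodCount n ℓ (n ∸ ℓ ∸ u) L U / 1) ℚ.* (½ ^ℚ (n ∸ ℓ ∸ u)))
      (+ n / 2)
      (n ∸ ℓ ∸ u)
proposition13 n ℓ u 4[ℓ+u]≤n L U L-low U-high =
  let Xs , Xl , bad≤Xs+Xl , Xl-bound , Xs-bound = UnionBound.badCount-split n ℓ u 4[ℓ+u]≤n L U L-low U-high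
  in probability-bound n m (∣ L ∣ ℕ.+ ∣ U ∣) (goodCount n ℓ m L U) (badCount n ℓ m L U) Xs Xl ⌊ n /2⌋
       (goodCount+badCount n ℓ m L U) bad≤Xs+Xl Xl-bound Xs-bound (⌊n/2⌋+⌊n/2⌋≤n n)
  where
  m = n ∸ ℓ ∸ u
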